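{- Let $r$ be a positive integer, $\mathbb{K}$ a field containing a primitive $r$-th root of unity $z$, and $G=([\ell],E)$ a simple graph on $\ell$ vertices. For a simple graph $H$ with vertex set $V$, let $\mathcal{M}(H,r)$ be the arrangement in $\mathbb{K}^{V}$ $$\mathcal{M}(H,r)=\{\ker(x_i-z^kx_j)\mid \{i,j\}\in E(H),\ 1\le k\le r\}\cup\{\ker x_i\mid i\in V\}.$$ If $e=\{i_1,i_2\}\in E$, then $$\chi(\mathcal{M}(G,r),t)=\chi(\mathcal{M}(G\setminus e,r),t)-r\,\chi(\mathcal{M}(G/e,r),t),$$ where $G\setminus e$ is $G$ with the edge $e$ deleted and $G/e$ is the simple graph obtained by contracting $e$ (identifying $i_1,i_2$ and removing loops and multiple edges).
   Context: For a central arrangement $\mathcal{A}$ in $\mathbb{K}^n$, $\chi(\mathcal{A},t)=\sum_{\mathcal{B}\subseteq\mathcal{A}}(-1)^{|\mathcal{B}|}t^{\dim\bigcap_{H\in\mathcal{B}}H}$, with the empty intersection equal to $\mathbb{K}^n$. $\mathcal{M}(H,r)$ is called the graphic monomial arrangement. -}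

module Defs where

open import Level using (Level; _⊔_) renaming (suc to lsuc)
open import Algebra.Bundles using (CommutativeRing)
open import Data.Nat as ℕ using (ℕ; zero; suc)
open import Data.Integer as ℤ using (ℤ)
open import Data.Fin as Fin using (Fin; toℕ; punchOut)
open import Data.Fin.Properties using (_≟_)
open import Data.Bool using (Bool; true; false; _∧_; _∨_; not; if_then_else_)
open import Data.List as List using (List; []; _∷_; _++_; concatMap; allFin; upTo)
open import Data.Bool.ListAction using (any)
open import Data.Unit.Polymorphic using (⊤)
open import Data.Product using (Σ; ∃; _×_; _,_)
open import Relation.Nullary using (¬_; Dec; yes; no)
open import Relation.Nullary.Decidable using (⌊_⌋)
open import Relation.Binary.PropositionalEquality using (_≡_; _≢_)

record Field (c ℓ : Level) : Set (lsuc (c ⊔ ℓ)) where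
  field
    commutativeRing : CommutativeRing c ℓ
  open CommutativeRing commutativeRing public
  field
    0≉1     : ¬ (0# ≈ 1#)
    inverse : ∀ x → ¬ (x ≈ 0#) → ∃ λ y → x * y ≈ 1#

module _ {c ℓ : Level} (K : Field c ℓ) where
  open Field K

  pow : Carrier → ℕ → Carrier
  pow x zero    = 1#
  pow x (suc k) = x * pow x k

  IsPrimitiveRoot : ℕ → Carrier → Set ℓ
  IsPrimitiveRoot r z = (pow z r ≈ 1#) × (∀ k → 1 ℕ.≤ k → k ℕ.< r → ¬ (pow z k ≈ 1#))

  Vect : ℕ → Set c
  Vect n = Fin n → Carrier

  Form : ℕ → Set c
  Form n = Fin n → Carrier

  sumF : ∀ {n} → (Fin n → Carrier) → Carrier
  sumF {zero}  f = 0#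
  sumF {suc n} f = f Fin.zero + sumF (λ i → f (Fin.suc i))

  eval : ∀ {n} → Form n → Vect n → Carrier
  eval α v = sumF (λ i → α i * v i)

  InKer : ∀ {n} → List (Form n) → Vect n → Set ℓ
  InKer []      v = ⊤ {ℓ}
  InKer (α ∷ B) v = (eval α v ≈ 0#) × InKer B v

  linComb : ∀ {n d} → (Fin d → Carrier) → (Fin d → Vect n) → Vect n
  linComb c b x = sumF (λ k → c k * b k x)

  HasBasis : ∀ {n} → List (Form n) → ℕ → Set (c ⊔ ℓ)
  HasBasis {n} B d = Σ (Fin d → Vect n) λ b →
      (∀ k → InKer B (b k))
    × (∀ (γ : Fin d → Carrier) → (∀ x → linComb γ b x ≈ 0#) → ∀ k → γ k ≈ 0#)
    × (∀ v → InKer B v → ∃ λ (γ : Fin d → Carrier) → ∀ x → v x ≈ linComb γ b x)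

  IsDimFun : ∀ {n} → (List (Form n) → ℕ) → Set (c ⊔ ℓ)
  IsDimFun {n} dim = ∀ (B : List (Form n)) → HasBasis B (dim B)

  subfamilies : ∀ {a} {A : Set a} → List A → List (List A)
  subfamilies []      = [] ∷ []
  subfamilies (x ∷ xs) = let s = subfamilies xs in s ++ List.map (x ∷_) s

  sign : ℕ → ℤ
  sign zero    = ℤ.1ℤ
  sign (suc k) = ℤ.- sign k

  charPoly : ∀ {n} → (List (Form n) → ℕ) → List (Form n) → ℤ → ℤ
  charPoly dim A t =
    List.foldr ℤ._+_ ℤ.0ℤ
      (List.map (λ B → sign (List.length B) ℤ.* (t ℤ.^ dim B)) (subfamilies A))

  coord : ∀ {n} → Fin n → Form n
  coord i x = if ⌊ x ≟ i ⌋ then 1# else 0#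

  diffForm : ∀ {n} → Carrier → ℕ → Fin n → Fin n → Form n
  diffForm z k i j x =
    if ⌊ x ≟ i ⌋ then 1# else (if ⌊ x ≟ j ⌋ then - pow z k else 0#)

Adjacency : ℕ → Set
Adjacency n = Fin n → Fin n → Bool

IsSimpleGraph : ∀ {n} → Adjacency n → Set
IsSimpleGraph adj = (∀ i j → adj i j ≡ adj j i) × (∀ i → adj i i ≡ false)

deleteEdge : ∀ {n} → Adjacency n → Fin n → Fin n → Adjacency n
deleteEdge adj i₁ i₂ i j =
  adj i j ∧ not ((⌊ i ≟ i₁ ⌋ ∧ ⌊ j ≟ i₂ ⌋) ∨ (⌊ i ≟ i₂ ⌋ ∧ ⌊ j ≟ i₁ ⌋))

-- the quotient map Fin (suc m) → Fin m identifying i₂ with i₁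
mergeMap : ∀ {m} (i₁ i₂ : Fin (suc m)) → i₁ ≢ i₂ → Fin (suc m) → Fin m
mergeMap i₁ i₂ ne v with i₂ ≟ v
... | yes _   = punchOut {i = i₂} {j = i₁} (λ eq → ne (Relation.Binary.PropositionalEquality.sym eq))
... | no i₂≢v = punchOut i₂≢v

contractEdge : ∀ {m} → Adjacency (suc m) → (i₁ i₂ : Fin (suc m)) → i₁ ≢ i₂ → Adjacency m
contractEdge {m} adj i₁ i₂ ne a b =
  not ⌊ a ≟ b ⌋ ∧
  any (λ u → any (λ v → ⌊ π u ≟ a ⌋ ∧ ⌊ π v ≟ b ⌋ ∧ adj u v) (allFin (suc m))) (allFin (suc m))
  where π = mergeMap i₁ i₂ ne

module _ {c ℓ : Level} (K : Field c ℓ) where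
  open Field K

  graphicMonomial : ∀ {n} → Adjacency n → ℕ → Carrier → List (Form K n)
  graphicMonomial {n} adj r z =
    concatMap (λ i → concatMap (λ j →
        if (adj i j ∧ ⌊ toℕ i ℕ.<? toℕ j ⌋)
          then List.map (λ k → diffForm K z (suc k) i j) (upTo r)
          else [])
      (allFin n)) (allFin n)
    ++ List.map (coord K) (allFin n)

-- Deletion–restriction gives χ(A ∪ {H}) = χ(A) − χ(A restricted to H). The arrangement M(G,r) is M(G∖e,r)
-- together with the r hyperplanes H_k : x_a = z^(k+1) x_b of the edge e = {a,b}; add them one at a time.
-- On H_k any other H_j forces x_b = 0, a hyperplane already in M(G∖e,r), so each restriction to H_k is that of
-- M(G∖e,r) alone. The linear isomorphism K^m ≅ H_k, u ↦ (w ↦ z^(shift w) u(π w)) with π the identification of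
-- a and b, pulls the hyperplanes of M(G∖e,r) back to exactly those of M(G/e,r) (x_i = ζ x_j with ζ running over
-- the r-th roots of unity is stable under rescaling by powers of z). Hence every H_k contributes χ(M(G/e,r)).
-- Dimensions are given only through bases, so their invariance under such isomorphisms rests on the Steinitz
-- exchange argument.
module Submission where

open import Defs
open import Algebra.Bundles using (CommutativeRing)
open import Data.Nat using (ℕ; suc)
open import Data.Fin using (Fin)
open import Relation.Binary.PropositionalEquality using (_≡_; _≢_)
open import Data.Bool using (true)
open import Data.Integer using (ℤ)
open import Data.List using (List)

-- Equality in R is undecidable, so the ring solver normalises with integer coefficients, mapped into R along ℤ → R.
module IntegerCoefficients {c ℓ} (R : CommutativeRing c ℓ) where
  open import Data.Nat as ℕ using (ℕ; zero; suc)
  import Data.Nat.Properties as ℕ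
  open import Data.Integer as ℤ using (ℤ; +_; -[1+_]; _⊖_)
  import Data.Integer.Properties as ℤ
  open import Data.Maybe using (Maybe; just; nothing)
  open import Relation.Nullary using (yes; no)
  open import Relation.Binary.PropositionalEquality as ≡ using (_≡_)
  open import Algebra.Solver.Ring.AlmostCommutativeRing
    using (_-Raw-AlmostCommutative⟶_; fromCommutativeRing)
  open CommutativeRing R
  open import Algebra.Properties.Ring ring
    using (-‿distribˡ-*; -‿distribʳ-*; -‿involutive; -0#≈0#; -‿+-comm)
  open import Algebra.Properties.Semiring.Mult semiring using (_×_; ×-homo-+; ×1-homo-*)
  open import Algebra.Properties.CommutativeSemigroup +-commutativeSemigroup using (interchange)
  open import Relation.Binary.Reasoning.Setoid setoid

  fromℤ : ℤ → Carrier
  fromℤ (+ n)    = n × 1#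
  fromℤ -[1+ n ] = - (suc n × 1#)

  private
    +-sub-+ : ∀ x a b → (x + a) - (x + b) ≈ a - b
    +-sub-+ x a b = begin
      (x + a) + - (x + b)     ≈⟨ +-congˡ (sym (-‿+-comm x b)) ⟩
      (x + a) + (- x + - b)   ≈⟨ interchange x a (- x) (- b) ⟩
      (x - x) + (a - b)       ≈⟨ +-congʳ (-‿inverseʳ x) ⟩
      0# + (a - b)            ≈⟨ +-identityˡ _ ⟩
      a - b                   ∎

    x≈x-0 : ∀ x → x ≈ x - 0#
    x≈x-0 x = sym (trans (+-congˡ -0#≈0#) (+-identityʳ x))

  fromℤ-⊖ : ∀ m n → fromℤ (m ⊖ n) ≈ m × 1# - n × 1#
  fromℤ-⊖ zero    zero    = x≈x-0 0#
  fromℤ-⊖ zero    (suc n) = sym (+-identityˡ _)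
  fromℤ-⊖ (suc m) zero    = x≈x-0 _
  fromℤ-⊖ (suc m) (suc n) = begin
    fromℤ (suc m ⊖ suc n)        ≡⟨ ≡.cong fromℤ (ℤ.[1+m]⊖[1+n]≡m⊖n m n) ⟩
    fromℤ (m ⊖ n)                ≈⟨ fromℤ-⊖ m n ⟩
    m × 1# - n × 1#              ≈⟨ sym (+-sub-+ 1# (m × 1#) (n × 1#)) ⟩
    suc m × 1# - suc n × 1#      ∎

  fromℤ-+ : ∀ i j → fromℤ (i ℤ.+ j) ≈ fromℤ i + fromℤ j
  fromℤ-+ (+ m)    (+ n)    = ×-homo-+ 1# m n
  fromℤ-+ (+ m)    -[1+ n ] = fromℤ-⊖ m (suc n)
  fromℤ-+ -[1+ m ] (+ n)    = trans (fromℤ-⊖ n (suc m)) (+-comm _ _)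
  fromℤ-+ -[1+ m ] -[1+ n ] = begin
    - (suc (suc (m ℕ.+ n)) × 1#)         ≡⟨ ≡.cong (λ k → - (k × 1#)) (≡.cong suc (≡.sym (ℕ.+-suc m n))) ⟩
    - ((suc m ℕ.+ suc n) × 1#)           ≈⟨ -‿cong (×-homo-+ 1# (suc m) (suc n)) ⟩
    - (suc m × 1# + suc n × 1#)          ≈⟨ sym (-‿+-comm _ _) ⟩
    - (suc m × 1#) + - (suc n × 1#)      ∎

  fromℤ-neg : ∀ i → fromℤ (ℤ.- i) ≈ - fromℤ i
  fromℤ-neg (+ zero)  = sym -0#≈0#
  fromℤ-neg (+ suc n) = refl
  fromℤ-neg -[1+ n ]  = sym (-‿involutive _)

  fromℤ-*-ℕ : ∀ m n → fromℤ (+ m ℤ.* + n) ≈ fromℤ (+ m) * fromℤ (+ n)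
  fromℤ-*-ℕ m n = trans (reflexive (≡.cong fromℤ (≡.sym (ℤ.pos-* m n)))) (×1-homo-* m n)

  fromℤ-* : ∀ i j → fromℤ (i ℤ.* j) ≈ fromℤ i * fromℤ j
  fromℤ-* (+ m)    (+ n)    = fromℤ-*-ℕ m n
  fromℤ-* (+ m)    -[1+ n ] = begin
    fromℤ (+ m ℤ.* ℤ.- + suc n)          ≡⟨ ≡.cong fromℤ (≡.sym (ℤ.neg-distribʳ-* (+ m) (+ suc n))) ⟩
    fromℤ (ℤ.- (+ m ℤ.* + suc n))        ≈⟨ fromℤ-neg (+ m ℤ.* + suc n) ⟩
    - fromℤ (+ m ℤ.* + suc n)            ≈⟨ -‿cong (fromℤ-*-ℕ m (suc n)) ⟩
    - (fromℤ (+ m) * fromℤ (+ suc n))    ≈⟨ -‿distribʳ-* _ _ ⟩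
    fromℤ (+ m) * fromℤ -[1+ n ]         ∎
  fromℤ-* -[1+ m ] (+ n)    = begin
    fromℤ (ℤ.- + suc m ℤ.* + n)          ≡⟨ ≡.cong fromℤ (≡.sym (ℤ.neg-distribˡ-* (+ suc m) (+ n))) ⟩
    fromℤ (ℤ.- (+ suc m ℤ.* + n))        ≈⟨ fromℤ-neg (+ suc m ℤ.* + n) ⟩
    - fromℤ (+ suc m ℤ.* + n)            ≈⟨ -‿cong (fromℤ-*-ℕ (suc m) n) ⟩
    - (fromℤ (+ suc m) * fromℤ (+ n))    ≈⟨ -‿distribˡ-* _ _ ⟩
    fromℤ -[1+ m ] * fromℤ (+ n)         ∎
  fromℤ-* -[1+ m ] -[1+ n ] = begin
    fromℤ (+ suc m ℤ.* + suc n)          ≈⟨ fromℤ-*-ℕ (suc m) (suc n) ⟩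
    x * y                                ≈⟨ *-cong (sym (-‿involutive x)) (sym (-‿involutive y)) ⟩
    - - x * - - y                        ≈⟨ sym (-‿distribˡ-* _ _) ⟩
    - (- x * - - y)                      ≈⟨ -‿cong (sym (-‿distribʳ-* _ _)) ⟩
    - - (- x * - y)                      ≈⟨ -‿involutive _ ⟩
    - x * - y                            ∎
    where x = suc m × 1#
          y = suc n × 1#

  fromℤ-morphism : ℤ.+-*-rawRing -Raw-AlmostCommutative⟶ fromCommutativeRing R
  fromℤ-morphism = record
    { ⟦_⟧ = fromℤ ; +-homo = fromℤ-+ ; *-homo = fromℤ-* ; -‿homo = fromℤ-neg
    ; 0-homo = refl ; 1-homo = +-identityʳ 1# }

  fromℤ-≟ : ∀ i j → Maybe (fromℤ i ≈ fromℤ j)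
  fromℤ-≟ i j with i ℤ.≟ j
  ... | yes ≡.refl = just refl
  ... | no _       = nothing

  open import Algebra.Solver.Ring ℤ.+-*-rawRing (fromCommutativeRing R) fromℤ-morphism fromℤ-≟ public
    using (solve; _:=_; _:+_; _:*_; _:-_; :-_)

module LinearAlgebra {c ℓ} (K : Field c ℓ) where
  open import Level using (_⊔_)
  open import Data.Nat as ℕ using (ℕ; zero; suc)
  import Data.Nat.Properties as ℕ
  open import Data.Fin as Fin using (Fin; punchIn; punchOut)
  open import Data.Fin.Properties using (_≟_; suc-injective; punchInᵢ≢i; punchOut-cong; punchOut-punchIn)
  open import Data.Product using (∃; _×_; _,_; proj₁; proj₂)
  open import Data.Sum using (_⊎_; inj₁; inj₂)
  open import Data.Empty using (⊥-elim)
  open import Data.List using (List)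
  open import Function using (_∘′_)
  open import Relation.Nullary using (¬_; yes; no)
  open import Relation.Nullary.Decidable using (¬¬-excluded-middle)
  open import Relation.Binary.PropositionalEquality as ≡ using (_≡_; _≢_)
  open Field K
  open IntegerCoefficients commutativeRing using (solve; _:=_; _:+_; _:*_; _:-_; :-_)
  open import Algebra.Properties.Ring ring using (-0#≈0#; -‿+-comm)
  open import Relation.Binary.Reasoning.Setoid setoid

  sumF-cong : ∀ {n} {f g : Fin n → Carrier} → (∀ i → f i ≈ g i) → sumF K f ≈ sumF K g
  sumF-cong {zero}  f≈g = refl
  sumF-cong {suc n} f≈g = +-cong (f≈g Fin.zero) (sumF-cong (λ i → f≈g (Fin.suc i)))

  sumF-+ : ∀ {n} (f g : Fin n → Carrier) → sumF K (λ i → f i + g i) ≈ sumF K f + sumF K g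
  sumF-+ {zero}  f g = sym (+-identityˡ 0#)
  sumF-+ {suc n} f g = trans (+-congˡ (sumF-+ (λ i → f (Fin.suc i)) (λ i → g (Fin.suc i))))
    (solve 4 (λ a b x y → (a :+ x) :+ (b :+ y) := (a :+ b) :+ (x :+ y)) refl _ _ _ _)

  sumF-*ˡ : ∀ {n} (x : Carrier) (f : Fin n → Carrier) → sumF K (λ i → x * f i) ≈ x * sumF K f
  sumF-*ˡ {zero}  x f = sym (zeroʳ x)
  sumF-*ˡ {suc n} x f = trans (+-congˡ (sumF-*ˡ x (λ i → f (Fin.suc i)))) (sym (distribˡ _ _ _))

  sumF-*ʳ : ∀ {n} (x : Carrier) (f : Fin n → Carrier) → sumF K (λ i → f i * x) ≈ sumF K f * x
  sumF-*ʳ {n} x f = trans (sumF-cong {n} (λ i → *-comm _ x)) (trans (sumF-*ˡ x f) (*-comm x _))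

  sumF-neg : ∀ {n} (f : Fin n → Carrier) → sumF K (λ i → - f i) ≈ - sumF K f
  sumF-neg {zero}  f = sym -0#≈0#
  sumF-neg {suc n} f = trans (+-congˡ (sumF-neg (λ i → f (Fin.suc i)))) (-‿+-comm _ _)

  sumF-sub : ∀ {n} (f g : Fin n → Carrier) → sumF K (λ i → f i - g i) ≈ sumF K f - sumF K g
  sumF-sub f g = trans (sumF-+ f (λ i → - g i)) (+-congˡ (sumF-neg g))

  sumF-zero : ∀ {n} (f : Fin n → Carrier) → (∀ i → f i ≈ 0#) → sumF K f ≈ 0#
  sumF-zero {n} f f≈0 = trans (sumF-cong f≈0) (sumF-const0 n)
    where
    sumF-const0 : ∀ n → sumF K {n} (λ _ → 0#) ≈ 0#
    sumF-const0 zero    = refl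
    sumF-const0 (suc n) = trans (+-identityˡ _) (sumF-const0 n)

  sumF-single : ∀ {n} (f : Fin n → Carrier) (i : Fin n) → (∀ j → j ≢ i → f j ≈ 0#) → sumF K f ≈ f i
  sumF-single f Fin.zero    f≈0 =
    trans (+-congˡ (sumF-zero _ (λ j → f≈0 (Fin.suc j) λ ()))) (+-identityʳ _)
  sumF-single f (Fin.suc i) f≈0 =
    trans (+-cong (f≈0 Fin.zero λ ()) (sumF-single (λ j → f (Fin.suc j)) i (λ j j≢i → f≈0 (Fin.suc j) (j≢i ∘′ suc-injective))))
          (+-identityˡ _)

  sumF-punchIn : ∀ {n} (f : Fin (suc n) → Carrier) (k : Fin (suc n)) →
                 sumF K f ≈ f k + sumF K (λ i → f (punchIn k i))
  sumF-punchIn f       Fin.zero    = refl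
  sumF-punchIn {suc n} f (Fin.suc k) = begin
    f Fin.zero + sumF K (λ i → f (Fin.suc i))                              ≈⟨ +-congˡ (sumF-punchIn (λ i → f (Fin.suc i)) k) ⟩
    f Fin.zero + (f (Fin.suc k) + sumF K (λ i → f (Fin.suc (punchIn k i)))) ≈⟨ solve 3 (λ a b s → a :+ (b :+ s) := b :+ (a :+ s)) refl _ _ _ ⟩
    f (Fin.suc k) + (f Fin.zero + sumF K (λ i → f (Fin.suc (punchIn k i)))) ∎

  x≉0∧xy≈0⇒y≈0 : ∀ {x y} → ¬ (x ≈ 0#) → x * y ≈ 0# → y ≈ 0#
  x≉0∧xy≈0⇒y≈0 {x} {y} x≉0 xy≈0 with inverse x x≉0
  ... | x⁻¹ , xx⁻¹≈1 = begin
    y              ≈⟨ sym (*-identityˡ y) ⟩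
    1# * y         ≈⟨ *-congʳ (sym xx⁻¹≈1) ⟩
    (x * x⁻¹) * y  ≈⟨ solve 3 (λ x x⁻¹ y → (x :* x⁻¹) :* y := x⁻¹ :* (x :* y)) refl x x⁻¹ y ⟩
    x⁻¹ * (x * y)  ≈⟨ *-congˡ xy≈0 ⟩
    x⁻¹ * 0#       ≈⟨ zeroʳ _ ⟩
    0#             ∎

  _≋_ : ∀ {n} → Vect K n → Vect K n → Set ℓ
  v ≋ w = ∀ x → v x ≈ w x

  Independent : ∀ {n d} → (Fin d → Vect K n) → Set (c ⊔ ℓ)
  Independent {d = d} b = ∀ (γ : Fin d → Carrier) → (∀ x → linComb K γ b x ≈ 0#) → ∀ k → γ k ≈ 0#

  _∈Span_ : ∀ {n d} → Vect K n → (Fin d → Vect K n) → Set (c ⊔ ℓ)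
  _∈Span_ {d = d} v b = ∃ λ (γ : Fin d → Carrier) → ∀ x → v x ≈ linComb K γ b x

  ¬¬-∃≉0⊎∀≈0 : ∀ {d} (a : Fin d → Carrier) → ¬ ¬ ((∃ λ k → ¬ (a k ≈ 0#)) ⊎ (∀ k → a k ≈ 0#))
  ¬¬-∃≉0⊎∀≈0 {zero}  a refute = refute (inj₂ λ ())
  ¬¬-∃≉0⊎∀≈0 {suc d} a refute = ¬¬-excluded-middle λ
    { (no a₀≉0)  → refute (inj₁ (Fin.zero , a₀≉0))
    ; (yes a₀≈0) → ¬¬-∃≉0⊎∀≈0 (λ i → a (Fin.suc i)) λ
      { (inj₁ (i , aᵢ≉0)) → refute (inj₁ (Fin.suc i , aᵢ≉0))
      ; (inj₂ rest≈0)     → refute (inj₂ λ { Fin.zero → a₀≈0 ; (Fin.suc i) → rest≈0 i }) } }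

  -- One step of Gaussian elimination: clear the first coordinate of all b k using the pivot b k₀.
  module Elimination {n d e} (b : Fin (suc e) → Vect K n) (cc : Fin (suc d) → Vect K n)
    (a : Fin (suc e) → Fin (suc d) → Carrier) (b≈a·cc : ∀ k x → b k x ≈ linComb K (a k) cc x)
    (k₀ : Fin (suc e)) (pivot≉0 : ¬ (a k₀ Fin.zero ≈ 0#)) where

    private
      pivot⁻¹ : Carrier
      pivot⁻¹ = proj₁ (inverse _ pivot≉0)

      μ : Fin e → Carrier
      μ i = a (punchIn k₀ i) Fin.zero * pivot⁻¹

      cleared : ∀ i → a (punchIn k₀ i) Fin.zero - μ i * a k₀ Fin.zero ≈ 0#
      cleared i = begin
        A - (A * pivot⁻¹) * P  ≈⟨ solve 3 (λ A y P → A :- (A :* y) :* P := A :- A :* (P :* y)) refl A pivot⁻¹ P ⟩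
        A - A * (P * pivot⁻¹)  ≈⟨ +-congˡ (-‿cong (*-congˡ (proj₂ (inverse _ pivot≉0)))) ⟩
        A - A * 1#             ≈⟨ +-congˡ (-‿cong (*-identityʳ A)) ⟩
        A - A                  ≈⟨ -‿inverseʳ A ⟩
        0#                     ∎
        where A = a (punchIn k₀ i) Fin.zero
              P = a k₀ Fin.zero

    b′ : Fin e → Vect K n
    b′ i x = b (punchIn k₀ i) x - μ i * b k₀ x

    b′∈Span : ∀ i → b′ i ∈Span (λ j → cc (Fin.suc j))
    b′∈Span i = (λ j → a (punchIn k₀ i) (Fin.suc j) - μ i * a k₀ (Fin.suc j)) , b′≈ i
      where
      b′≈ : ∀ i x → b′ i x ≈ linComb K (λ j → a (punchIn k₀ i) (Fin.suc j) - μ i * a k₀ (Fin.suc j)) (λ j → cc (Fin.suc j)) x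
      b′≈ i x = begin
        b (punchIn k₀ i) x - μ i * b k₀ x
          ≈⟨ +-cong (b≈a·cc (punchIn k₀ i) x) (-‿cong (*-congˡ (b≈a·cc k₀ x))) ⟩
        (A * c₀ + S₁) - μ i * (P * c₀ + S₂)
          ≈⟨ solve 6 (λ A P μ c₀ S₁ S₂ → (A :* c₀ :+ S₁) :- μ :* (P :* c₀ :+ S₂) := (A :- μ :* P) :* c₀ :+ (S₁ :- μ :* S₂)) refl A P (μ i) c₀ S₁ S₂ ⟩
        (A - μ i * P) * c₀ + (S₁ - μ i * S₂)
          ≈⟨ +-congʳ (trans (*-congʳ (cleared i)) (zeroˡ c₀)) ⟩
        0# + (S₁ - μ i * S₂)
          ≈⟨ +-identityˡ _ ⟩
        S₁ - μ i * S₂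
          ≈⟨ +-congˡ (-‿cong (sym (sumF-*ˡ {d} (μ i) _))) ⟩
        S₁ - sumF K (λ j → μ i * (a k₀ (Fin.suc j) * cc (Fin.suc j) x))
          ≈⟨ sym (sumF-sub {d} _ _) ⟩
        sumF K (λ j → a (punchIn k₀ i) (Fin.suc j) * cc (Fin.suc j) x - μ i * (a k₀ (Fin.suc j) * cc (Fin.suc j) x))
          ≈⟨ sumF-cong {d} (λ j → solve 4 (λ p q μ y → p :* y :- μ :* (q :* y) := (p :- μ :* q) :* y) refl _ _ (μ i) _) ⟩
        linComb K (λ j → a (punchIn k₀ i) (Fin.suc j) - μ i * a k₀ (Fin.suc j)) (λ j → cc (Fin.suc j)) x ∎
        where A  = a (punchIn k₀ i) Fin.zero
              P  = a k₀ Fin.zero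
              c₀ = cc Fin.zero x
              S₁ = sumF K (λ j → a (punchIn k₀ i) (Fin.suc j) * cc (Fin.suc j) x)
              S₂ = sumF K (λ j → a k₀ (Fin.suc j) * cc (Fin.suc j) x)

    -- A relation Σ γ i b′ i = 0 is the relation on b with coefficient γ i at punchIn k₀ i and - Σ γ i μ i at k₀.
    b′-independent : Independent b → Independent b′
    b′-independent ind γ Σγb′≈0 i = trans (sym (δ-punchIn i)) (ind δ Σδb≈0 (punchIn k₀ i))
      where
      M : Carrier
      M = sumF K (λ i → γ i * μ i)

      δ : Fin (suc e) → Carrier
      δ k with k₀ ≟ k
      ... | yes _    = - M
      ... | no k₀≢k = γ (punchOut k₀≢k)

      δ-punchIn : ∀ i → δ (punchIn k₀ i) ≈ γ i
      δ-punchIn i with k₀ ≟ punchIn k₀ i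
      ... | yes k₀≡ = ⊥-elim (punchInᵢ≢i k₀ i (≡.sym k₀≡))
      ... | no _    = reflexive (≡.cong γ (≡.trans (punchOut-cong k₀ ≡.refl) (punchOut-punchIn k₀)))

      δ-pivot : δ k₀ ≈ - M
      δ-pivot with k₀ ≟ k₀
      ... | yes _    = refl
      ... | no k₀≢k₀ = ⊥-elim (k₀≢k₀ ≡.refl)

      Σδb≈0 : ∀ x → linComb K δ b x ≈ 0#
      Σδb≈0 x = begin
        sumF K (λ k → δ k * b k x)
          ≈⟨ sumF-punchIn (λ k → δ k * b k x) k₀ ⟩
        δ k₀ * Q + sumF K (λ i → δ (punchIn k₀ i) * b (punchIn k₀ i) x)
          ≈⟨ +-cong (*-congʳ δ-pivot) (sumF-cong (λ i → *-congʳ (δ-punchIn i))) ⟩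
        - M * Q + S
          ≈⟨ solve 3 (λ M Q S → :- M :* Q :+ S := S :- M :* Q) refl M Q S ⟩
        S - M * Q
          ≈⟨ +-congˡ (-‿cong (sym (sumF-*ʳ {e} Q _))) ⟩
        S - sumF K (λ i → (γ i * μ i) * Q)
          ≈⟨ sym (sumF-sub {e} _ _) ⟩
        sumF K (λ i → γ i * b (punchIn k₀ i) x - (γ i * μ i) * Q)
          ≈⟨ sumF-cong {e} (λ i → solve 4 (λ g p m q → g :* p :- (g :* m) :* q := g :* (p :- m :* q)) refl (γ i) _ (μ i) Q) ⟩
        linComb K γ b′ x
          ≈⟨ Σγb′≈0 x ⟩
        0# ∎
        where Q = b k₀ x
              S = sumF K (λ i → γ i * b (punchIn k₀ i) x)

  -- Equality in K is undecidable, so the pivot is chosen under a double negation; harmless, as the goal is ⊥.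
  ¬independent-in-smaller-span : ∀ {n d′ d} {b : Fin d → Vect K n} {cc : Fin d′ → Vect K n} →
    Independent b → (∀ k → b k ∈Span cc) → ¬ (d′ ℕ.< d)
  ¬independent-in-smaller-span {d′ = zero} {suc e} {b} ind b∈cc _ =
    0≉1 (sym (ind indicator Σ≈0 Fin.zero))
    where
    indicator : Fin (suc e) → Carrier
    indicator Fin.zero    = 1#
    indicator (Fin.suc _) = 0#
    Σ≈0 : ∀ x → linComb K indicator b x ≈ 0#
    Σ≈0 x = trans (+-cong (*-identityˡ _) (sumF-zero {e} _ (λ _ → zeroˡ _)))
                  (trans (+-identityʳ _) (proj₂ (b∈cc Fin.zero) x))
  ¬independent-in-smaller-span {d′ = suc d″} {suc e} {b} {cc} ind b∈cc (ℕ.s≤s d″<e) =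
    ¬¬-∃≉0⊎∀≈0 (λ k → a k Fin.zero) λ
      { (inj₂ firsts≈0) →
          ¬independent-in-smaller-span ind (∈tail firsts≈0) (ℕ.m<n⇒m<1+n d″<e)
      ; (inj₁ (k₀ , pivot≉0)) → let open Elimination b cc a (λ k → proj₂ (b∈cc k)) k₀ pivot≉0 in
          ¬independent-in-smaller-span (b′-independent ind) b′∈Span d″<e }
    where
    a : Fin (suc e) → Fin (suc d″) → Carrier
    a k = proj₁ (b∈cc k)
    ∈tail : (∀ k → a k Fin.zero ≈ 0#) → ∀ k → b k ∈Span (λ j → cc (Fin.suc j))
    ∈tail firsts≈0 k = (λ j → a k (Fin.suc j)) , λ x →
      trans (proj₂ (b∈cc k) x) (trans (+-congʳ (trans (*-congʳ (firsts≈0 k)) (zeroˡ _))) (+-identityˡ _))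

  independent-in-span⇒≤ : ∀ {n d′ d} {b : Fin d → Vect K n} {cc : Fin d′ → Vect K n} →
    Independent b → (∀ k → b k ∈Span cc) → d ℕ.≤ d′
  independent-in-span⇒≤ ind b∈cc = ℕ.≮⇒≥ (¬independent-in-smaller-span ind b∈cc)

  eval-cong : ∀ {n} (α : Form K n) {v w : Vect K n} → v ≋ w → eval K α v ≈ eval K α w
  eval-cong α v≋w = sumF-cong (λ i → *-congˡ (v≋w i))

  record InjectiveLinearMap (m n : ℕ) : Set (c ⊔ ℓ) where
    field
      apply     : Vect K m → Vect K n
      apply-cong : ∀ {u u′} → u ≋ u′ → apply u ≋ apply u′
      linear    : ∀ {k} (γ : Fin k → Carrier) (u : Fin k → Vect K m) →
                  apply (linComb K γ u) ≋ linComb K γ (λ i → apply (u i))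
      injective : ∀ u → apply u ≋ (λ _ → 0#) → u ≋ (λ _ → 0#)

  identityMap : ∀ {n} → InjectiveLinearMap n n
  identityMap = record
    { apply = λ u → u ; apply-cong = λ u≋u′ → u≋u′ ; linear = λ γ u x → refl ; injective = λ u u≋0 → u≋0 }

  module _ {m n} (φ : InjectiveLinearMap m n) where
    open InjectiveLinearMap φ

    MapsOnto : List (Form K m) → List (Form K n) → Set (c ⊔ ℓ)
    MapsOnto S′ S = (∀ v → InKer K S v → ∃ λ u → InKer K S′ u × v ≋ apply u)
                  × (∀ u → InKer K S′ u → InKer K S (apply u))

    basis-size-unique : ∀ {S′ S d′ d} → MapsOnto S′ S → HasBasis K S d → HasBasis K S′ d′ → d ≡ d′
    basis-size-unique {S′} {S} {d′} {d} (onto , into) (b , b∈S , b-ind , S⊆span) (b′ , b′∈S′ , b′-ind , S′⊆span) =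
      ℕ.≤-antisym (independent-in-span⇒≤ u-ind (λ k → S′⊆span (u k) (u∈S′ k)))
                  (independent-in-span⇒≤ φb′-ind (λ k → S⊆span (apply (b′ k)) (into (b′ k) (b′∈S′ k))))
      where
      preimage : ∀ k → ∃ λ u → InKer K S′ u × b k ≋ apply u
      preimage k = onto (b k) (b∈S k)
      u : Fin d → Vect K m
      u k = proj₁ (preimage k)
      u∈S′ : ∀ k → InKer K S′ (u k)
      u∈S′ k = proj₁ (proj₂ (preimage k))
      u-ind : Independent u
      u-ind γ Σγu≈0 = b-ind γ λ x → begin
        sumF K (λ k → γ k * b k x)           ≈⟨ sumF-cong (λ k → *-congˡ (proj₂ (proj₂ (preimage k)) x)) ⟩
        linComb K γ (λ k → apply (u k)) x    ≈⟨ sym (linear γ u x) ⟩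
        apply (linComb K γ u) x              ≈⟨ apply-cong Σγu≈0 x ⟩
        apply (λ _ → 0#) x                   ≈⟨ linear {0} (λ ()) (λ ()) x ⟩
        0#                                   ∎
      φb′-ind : Independent (λ k → apply (b′ k))
      φb′-ind γ Σγφb′≈0 = b′-ind γ (injective (linComb K γ b′) (λ x → trans (linear γ b′ x) (Σγφb′≈0 x)))

  dim-cong : ∀ {n} {dim : List (Form K n) → ℕ} → IsDimFun K dim → ∀ {S S′} →
             (∀ v → InKer K S v → InKer K S′ v) → (∀ v → InKer K S′ v → InKer K S v) → dim S ≡ dim S′
  dim-cong isDim {S} {S′} S⊆S′ S′⊆S =
    basis-size-unique identityMap ((λ v v∈S → v , S⊆S′ v v∈S , λ _ → refl) , S′⊆S) (isDim S) (isDim S′)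

module Restriction {c ℓ} (K : Field c ℓ) {n : ℕ} (dim : List (Form K n) → ℕ) (isDim : IsDimFun K dim) (t : ℤ) where
  open import Data.Integer as ℤ using (_+_; _-_; -_; _*_; 0ℤ)
  import Data.Integer.Properties as ℤ
  open import Data.Integer.Tactic.RingSolver using (solve-∀)
  open import Data.Product using (∃; _×_; _,_; proj₁; proj₂; map₂)
  open import Data.List as List using ([]; _∷_; _++_; map; length; foldr)
  import Data.List.Properties as List
  open import Data.List.Membership.Propositional using (_∈_)
  open import Data.List.Membership.Propositional.Properties using (∈-++⁺ʳ)
  open import Data.List.Relation.Unary.Any using (here; there)
  open import Data.List.Relation.Binary.Permutation.Propositional using (_↭_; refl; prep; swap; trans)
  open import Data.List.Relation.Binary.Permutation.Propositional.Properties using (++-comm)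
  open import Relation.Binary.PropositionalEquality as ≡ using (_≡_; cong; cong₂)
  open import Function using (_∘′_)
  open import Level using (_⊔_)
  open Field K using (_≈_; 0#)
  open LinearAlgebra K using (dim-cong)
  open ≡.≡-Reasoning

  -- χ-on S A = Σ_{B ⊆ A} (-1)^|B| t^dim(⋂ (B ∪ S)), the characteristic polynomial of A restricted to ⋂ S,
  -- computed by deletion–restriction.
  χ-on : List (Form K n) → List (Form K n) → ℤ
  χ-on S []      = t ℤ.^ dim S
  χ-on S (α ∷ A) = χ-on S A - χ-on (α ∷ S) A

  InKer-++⁻ : ∀ (B S : List (Form K n)) {v} → InKer K (B ++ S) v → InKer K B v × InKer K S v
  InKer-++⁻ []      S v∈S             = _ , v∈S
  InKer-++⁻ (α ∷ B) S (αv≈0 , v∈B++S) = let (v∈B , v∈S) = InKer-++⁻ B S v∈B++S in (αv≈0 , v∈B) , v∈S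

  InKer-++⁺ : ∀ (B S : List (Form K n)) {v} → InKer K B v → InKer K S v → InKer K (B ++ S) v
  InKer-++⁺ []      S _               v∈S = v∈S
  InKer-++⁺ (α ∷ B) S (αv≈0 , v∈B) v∈S = αv≈0 , InKer-++⁺ B S v∈B v∈S

  _≐_ : List (Form K n) → List (Form K n) → Set (c ⊔ ℓ)
  S ≐ S′ = (∀ v → InKer K S v → InKer K S′ v) × (∀ v → InKer K S′ v → InKer K S v)

  χ-on-cong : ∀ A {S S′} → S ≐ S′ → χ-on S A ≡ χ-on S′ A
  χ-on-cong []      (S⊆S′ , S′⊆S) = cong (t ℤ.^_) (dim-cong isDim S⊆S′ S′⊆S)
  χ-on-cong (α ∷ A) (S⊆S′ , S′⊆S) = cong₂ _-_ (χ-on-cong A (S⊆S′ , S′⊆S))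
    (χ-on-cong A ((λ v → map₂ (S⊆S′ v)) , (λ v → map₂ (S′⊆S v))))

  private
    sumℤ : List ℤ → ℤ
    sumℤ = foldr _+_ 0ℤ

    sumℤ-++ : ∀ xs ys → sumℤ (xs ++ ys) ≡ sumℤ xs + sumℤ ys
    sumℤ-++ []       ys = ≡.sym (ℤ.+-identityˡ _)
    sumℤ-++ (x ∷ xs) ys = ≡.trans (cong (x +_) (sumℤ-++ xs ys)) (≡.sym (ℤ.+-assoc x _ _))

    sumℤ-neg : ∀ xs → sumℤ (map -_ xs) ≡ - sumℤ xs
    sumℤ-neg []       = ≡.refl
    sumℤ-neg (x ∷ xs) = ≡.trans (cong (- x +_) (sumℤ-neg xs)) (≡.sym (ℤ.neg-distrib-+ x _))

    term : List (Form K n) → List (Form K n) → ℤ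
    term S B = sign K (length B) * t ℤ.^ dim (B ++ S)

    subfamilySum≡χ-on : ∀ A S → sumℤ (map (term S) (subfamilies K A)) ≡ χ-on S A
    subfamilySum≡χ-on []      S = ≡.trans (ℤ.+-identityʳ _) (ℤ.*-identityˡ _)
    subfamilySum≡χ-on (α ∷ A) S = begin
      sumℤ (map (term S) (s ++ map (α ∷_) s))                   ≡⟨ cong sumℤ (List.map-++ (term S) s _) ⟩
      sumℤ (map (term S) s ++ map (term S) (map (α ∷_) s))      ≡⟨ sumℤ-++ (map (term S) s) _ ⟩
      sumℤ (map (term S) s) + sumℤ (map (term S) (map (α ∷_) s)) ≡⟨ cong (λ xs → sumℤ (map (term S) s) + sumℤ xs) term-α∷ ⟩
      sumℤ (map (term S) s) + sumℤ (map -_ (map (term (α ∷ S)) s)) ≡⟨ cong (sumℤ (map (term S) s) +_) (sumℤ-neg (map (term (α ∷ S)) s)) ⟩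
      sumℤ (map (term S) s) - sumℤ (map (term (α ∷ S)) s)        ≡⟨ cong₂ _-_ (subfamilySum≡χ-on A S) (subfamilySum≡χ-on A (α ∷ S)) ⟩
      χ-on S A - χ-on (α ∷ S) A                                  ∎
      where
      s = subfamilies K A
      moveα : ∀ B → (α ∷ B ++ S) ≐ (B ++ α ∷ S)
      moveα B = (λ v (αv≈0 , v∈B++S) → let (v∈B , v∈S) = InKer-++⁻ B S v∈B++S in InKer-++⁺ B (α ∷ S) v∈B (αv≈0 , v∈S))
              , (λ v v∈B++αS → let (v∈B , (αv≈0 , v∈S)) = InKer-++⁻ B (α ∷ S) v∈B++αS in αv≈0 , InKer-++⁺ B S v∈B v∈S)
      term-α∷ : map (term S) (map (α ∷_) s) ≡ map -_ (map (term (α ∷ S)) s)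
      term-α∷ = ≡.trans (≡.sym (List.map-∘ s)) (≡.trans (List.map-cong (λ B →
        ≡.trans (cong (λ d → - sign K (length B) * t ℤ.^ d) (dim-cong isDim (proj₁ (moveα B)) (proj₂ (moveα B))))
                (≡.sym (ℤ.neg-distribˡ-* (sign K (length B)) _))) s) (List.map-∘ s))

  charPoly≡χ-on[] : ∀ A → charPoly K dim A t ≡ χ-on [] A
  charPoly≡χ-on[] A = ≡.trans
    (cong sumℤ (List.map-cong (λ B → cong (λ S → sign K (length B) * t ℤ.^ dim S) (≡.sym (List.++-identityʳ B))) (subfamilies K A)))
    (subfamilySum≡χ-on A [])

  χ-on-swap : ∀ S α β A → χ-on S (α ∷ β ∷ A) ≡ χ-on S (β ∷ α ∷ A)
  χ-on-swap S α β A = ≡.trans (exchange (χ-on S A) (χ-on (β ∷ S) A) (χ-on (α ∷ S) A) (χ-on (β ∷ α ∷ S) A))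
    (cong (λ x → χ-on S A - χ-on (α ∷ S) A - (χ-on (β ∷ S) A - x)) (χ-on-cong A (swap₂ , swap₂)))
    where
    exchange : ∀ a b c d → (a - b) - (c - d) ≡ (a - c) - (b - d)
    exchange = solve-∀
    swap₂ : ∀ {α β S} v → InKer K (α ∷ β ∷ S) v → InKer K (β ∷ α ∷ S) v
    swap₂ v (αv≈0 , βv≈0 , v∈S) = βv≈0 , αv≈0 , v∈S

  χ-on-↭ : ∀ {A A′} → A ↭ A′ → ∀ S → χ-on S A ≡ χ-on S A′
  χ-on-↭ refl                     S = ≡.refl
  χ-on-↭ (prep α A↭A′)            S = cong₂ _-_ (χ-on-↭ A↭A′ S) (χ-on-↭ A↭A′ (α ∷ S))
  χ-on-↭ (swap {ys = A′} α β A↭A′) S = ≡.trans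
    (cong₂ _-_ (cong₂ _-_ (χ-on-↭ A↭A′ S) (χ-on-↭ A↭A′ (β ∷ S))) (cong₂ _-_ (χ-on-↭ A↭A′ (α ∷ S)) (χ-on-↭ A↭A′ (β ∷ α ∷ S))))
    (χ-on-swap S α β A′)
  χ-on-↭ (trans A↭B B↭C)          S = ≡.trans (χ-on-↭ A↭B S) (χ-on-↭ B↭C S)

  -- Restricting to ker β gives the same space as not restricting, so the two terms cancel.
  χ-on-vanishing : ∀ {β A} → β ∈ A → ∀ S → (∀ v → InKer K S v → eval K β v ≈ 0#) → χ-on S A ≡ 0ℤ
  χ-on-vanishing {β} {β ∷ A} (here ≡.refl) S β|S≈0 =
    ≡.trans (cong (λ x → χ-on S A - x) (χ-on-cong A ((λ _ → proj₂) , (λ v v∈S → β|S≈0 v v∈S , v∈S))))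
            (ℤ.+-inverseʳ (χ-on S A))
  χ-on-vanishing {β} {γ ∷ A} (there β∈A) S β|S≈0 =
    cong₂ _-_ (χ-on-vanishing β∈A S β|S≈0) (χ-on-vanishing β∈A (γ ∷ S) (λ v → β|S≈0 v ∘′ proj₂))

  Absorbed : List (Form K n) → List (Form K n) → List (Form K n) → Set (c ⊔ ℓ)
  Absorbed S X Y = ∀ {α} → α ∈ X → ∃ λ β → β ∈ Y × (∀ v → InKer K S v → eval K α v ≈ 0# → eval K β v ≈ 0#)

  χ-on-++-absorbed : ∀ S X Y → Absorbed S X Y → χ-on S (X ++ Y) ≡ χ-on S Y
  χ-on-++-absorbed S []      Y X⊑Y = ≡.refl
  χ-on-++-absorbed S (α ∷ X) Y X⊑Y with X⊑Y (here ≡.refl)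
  ... | β , β∈Y , α⇒β = ≡.trans
    (cong₂ _-_ (χ-on-++-absorbed S X Y (X⊑Y ∘′ there))
               (χ-on-vanishing (∈-++⁺ʳ X β∈Y) (α ∷ S) (λ v (αv≈0 , v∈S) → α⇒β v v∈S αv≈0)))
    (ℤ.+-identityʳ _)

  χ-on-absorbed : ∀ S A B → Absorbed S A B → Absorbed S B A → χ-on S A ≡ χ-on S B
  χ-on-absorbed S A B A⊑B B⊑A = begin
    χ-on S A        ≡⟨ ≡.sym (χ-on-++-absorbed S B A B⊑A) ⟩
    χ-on S (B ++ A) ≡⟨ χ-on-↭ (++-comm B A) S ⟩
    χ-on S (A ++ B) ≡⟨ χ-on-++-absorbed S A B A⊑B ⟩
    χ-on S B        ∎

module Transport {c ℓ} (K : Field c ℓ) {m n : ℕ}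
  (dim : List (Form K n) → ℕ) (isDim : IsDimFun K dim)
  (dim′ : List (Form K m) → ℕ) (isDim′ : IsDimFun K dim′) (t : ℤ)
  (φ : LinearAlgebra.InjectiveLinearMap K m n) where
  open import Data.Product using (∃; Σ; _×_; _,_)
  open import Data.List using ([]; _∷_)
  open import Data.List.Membership.Propositional using (_∈_)
  open import Data.List.Relation.Unary.Any using (here; there)
  open import Data.List.Relation.Binary.Pointwise using (Pointwise; []; _∷_)
  open import Relation.Binary.PropositionalEquality as ≡ using (_≡_; cong; cong₂)
  open import Data.Integer using (_-_; _^_)
  open import Level using (_⊔_)
  open import Function.Bundles using (_⇔_; Equivalence)
  open Field K using (_≈_; 0#; sym; trans)
  open LinearAlgebra K using (InjectiveLinearMap; MapsOnto; basis-size-unique; eval-cong)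
  open InjectiveLinearMap φ
  open Restriction K dim isDim t using (χ-on)
  open Restriction K dim′ isDim′ t using () renaming (χ-on to χ-on′; χ-on-absorbed to χ-on′-absorbed)

  PullsBackTo : Form K n → Form K m → Set (c ⊔ ℓ)
  PullsBackTo α β = ∀ u → (eval K α (apply u) ≈ 0#) ⇔ (eval K β u ≈ 0#)

  χ-on-pointwise : ∀ {A B} → Pointwise PullsBackTo A B → ∀ {S S′} → MapsOnto φ S′ S → χ-on S A ≡ χ-on′ S′ B
  χ-on-pointwise [] {S} {S′} onto = cong (t ^_) (basis-size-unique φ onto (isDim S) (isDim′ S′))
  χ-on-pointwise {α ∷ A} {β ∷ B} (α~β ∷ A~B) (onto , into) =
    cong₂ _-_ (χ-on-pointwise A~B (onto , into)) (χ-on-pointwise A~B (onto′ , into′))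
    where
    onto′ : ∀ v → InKer K (α ∷ _) v → ∃ λ u → InKer K (β ∷ _) u × (∀ x → v x ≈ apply u x)
    onto′ v (αv≈0 , v∈S) with onto v v∈S
    ... | u , u∈S′ , v≋φu = u , (Equivalence.to (α~β u) (trans (sym (eval-cong α v≋φu)) αv≈0) , u∈S′) , v≋φu
    into′ : ∀ u → InKer K (β ∷ _) u → InKer K (α ∷ _) (apply u)
    into′ u (βu≈0 , u∈S′) = Equivalence.from (α~β u) βu≈0 , into u u∈S′

  private
    Matched : List (Form K n) → List (Form K m) → Set (c ⊔ ℓ)
    Matched A B = ∀ {α} → α ∈ A → ∃ λ β → β ∈ B × PullsBackTo α β

    matching : ∀ A B → Matched A B →
      Σ (List (Form K m)) λ B′ → Pointwise PullsBackTo A B′ × (∀ {β} → β ∈ B′ → β ∈ B) × Matched A B′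
    matching []      B A→B = [] , [] , (λ ()) , (λ ())
    matching (α ∷ A) B A→B with A→B (here ≡.refl) | matching A B (λ α∈A → A→B (there α∈A))
    ... | β , β∈B , α~β | B′ , A~B′ , B′⊆B , A→B′ =
      β ∷ B′ , α~β ∷ A~B′ , (λ { (here ≡.refl) → β∈B ; (there β′∈B′) → B′⊆B β′∈B′ }) ,
      (λ { (here ≡.refl) → β , here ≡.refl , α~β
         ; (there α′∈A) → let (β′ , β′∈B′ , α′~β′) = A→B′ α′∈A in β′ , there β′∈B′ , α′~β′ })

  χ-on-transport : ∀ {S S′} A B → MapsOnto φ S′ S →
    (∀ {α} → α ∈ A → ∃ λ β → β ∈ B × PullsBackTo α β) →
    (∀ {β} → β ∈ B → ∃ λ α → α ∈ A × PullsBackTo α β) → χ-on S A ≡ χ-on′ S′ B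
  χ-on-transport {S′ = S′} A B onto A→B B→A with matching A B A→B
  ... | B′ , A~B′ , B′⊆B , A→B′ =
    ≡.trans (χ-on-pointwise A~B′ onto) (χ-on′-absorbed S′ B′ B (λ β∈B′ → _ , B′⊆B β∈B′ , λ _ _ βu≈0 → βu≈0) B⊑B′)
    where
    B⊑B′ : ∀ {β} → β ∈ B → ∃ λ β′ → β′ ∈ B′ × (∀ u → InKer K S′ u → eval K β u ≈ 0# → eval K β′ u ≈ 0#)
    B⊑B′ β∈B with B→A β∈B
    ... | α , α∈A , α~β with A→B′ α∈A
    ... | β′ , β′∈B′ , α~β′ = β′ , β′∈B′ , λ u _ βu≈0 → Equivalence.to (α~β′ u) (Equivalence.from (α~β u) βu≈0)

module RootOfUnity {c ℓ} (K : Field c ℓ) (r′ : ℕ) (z : Field.Carrier K) (isPrimitive : IsPrimitiveRoot K (suc r′) z) where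
  open import Data.Nat as ℕ using (zero; suc; _<_; _%_; _/_)
  import Data.Nat.Properties as ℕ
  open import Data.Nat.DivMod using (m≡m%n+[m/n]*n; m%n<n)
  open import Data.Product using (∃; _×_; _,_; proj₁; proj₂)
  open import Data.Empty using (⊥-elim)
  open import Relation.Nullary using (¬_)
  open import Relation.Binary.PropositionalEquality as ≡ using (_≡_)
  open import Relation.Binary.Definitions using (tri<; tri≈; tri>)
  open import Function.Bundles using (_⇔_; mk⇔)
  open Field K
  open IntegerCoefficients commutativeRing using (solve; _:=_; _:*_)
  open import Relation.Binary.Reasoning.Setoid setoid

  r : ℕ
  r = suc r′

  z^_ : ℕ → Carrier
  z^_ = pow K z

  z^-cong : ∀ {a b} → a ≡ b → z^ a ≈ z^ b
  z^-cong ≡.refl = refl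

  z^-+ : ∀ a b → z^ (a ℕ.+ b) ≈ z^ a * z^ b
  z^-+ zero    b = sym (*-identityˡ _)
  z^-+ (suc a) b = trans (*-congˡ (z^-+ a b)) (sym (*-assoc _ _ _))

  z^-*r : ∀ q → z^ (q ℕ.* r) ≈ 1#
  z^-*r zero    = refl
  z^-*r (suc q) = trans (z^-+ r (q ℕ.* r)) (trans (*-cong (proj₁ isPrimitive) (z^-*r q)) (*-identityˡ _))

  -- k + k * r′ = k * r
  z^-inverse : ∀ k → z^ k * z^ (k ℕ.* r′) ≈ 1#
  z^-inverse k = trans (sym (z^-+ k (k ℕ.* r′))) (trans (z^-cong (≡.sym (ℕ.*-suc k r′))) (z^-*r k))

  z^-cancelˡ : ∀ k x → z^ (k ℕ.* r′) * (z^ k * x) ≈ x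
  z^-cancelˡ k x = trans (sym (*-assoc _ _ _)) (trans (*-congʳ (trans (*-comm _ _) (z^-inverse k))) (*-identityˡ x))

  z^-cancelʳ : ∀ k x → z^ k * (z^ (k ℕ.* r′) * x) ≈ x
  z^-cancelʳ k x = trans (sym (*-assoc _ _ _)) (trans (*-congʳ (z^-inverse k)) (*-identityˡ x))

  z^≉0 : ∀ k → ¬ (z^ k ≈ 0#)
  z^≉0 k z^k≈0 = 0≉1 (trans (sym (zeroˡ (z^ (k ℕ.* r′)))) (trans (*-congʳ (sym z^k≈0)) (z^-inverse k)))

  z^-%r : ∀ x → z^ (x % r) ≈ z^ x
  z^-%r x = sym (begin
    z^ x                             ≡⟨ ≡.cong z^_ (m≡m%n+[m/n]*n x r) ⟩
    z^ (x % r ℕ.+ (x / r) ℕ.* r)     ≈⟨ z^-+ (x % r) _ ⟩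
    z^ (x % r) * z^ ((x / r) ℕ.* r)  ≈⟨ *-congˡ (z^-*r (x / r)) ⟩
    z^ (x % r) * 1#                  ≈⟨ *-identityʳ _ ⟩
    z^ (x % r)                       ∎)

  z^-as-z^suc : ∀ e → ∃ λ j → j < r × z^ (suc j) ≈ z^ e
  z^-as-z^suc e = (e ℕ.+ r′) % r , m%n<n (e ℕ.+ r′) r , (begin
    z * z^ ((e ℕ.+ r′) % r)  ≈⟨ *-congˡ (z^-%r (e ℕ.+ r′)) ⟩
    z^ (suc (e ℕ.+ r′))      ≡⟨ ≡.cong z^_ (≡.sym (ℕ.+-suc e r′)) ⟩
    z^ (e ℕ.+ r)             ≈⟨ z^-+ e r ⟩
    z^ e * z^ r              ≈⟨ *-congˡ (proj₁ isPrimitive) ⟩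
    z^ e * 1#                ≈⟨ *-identityʳ _ ⟩
    z^ e                     ∎)

  -- Otherwise z^ (k - j) ≈ 1# with 0 < k - j < r.
  z^suc-< : ∀ {j k} → j < k → k < r → ¬ (z^ (suc j) ≈ z^ (suc k))
  z^suc-< {j} {k} j<k k<r eq with ℕ.m≤n⇒∃[o]m+o≡n j<k
  ... | o , suc-j+o≡k = proj₂ isPrimitive (suc o) (ℕ.s≤s ℕ.z≤n) o<r (begin
    z^ (suc o)                                    ≈⟨ sym (z^-cancelˡ (suc j) _) ⟩
    z^ (suc j ℕ.* r′) * (z^ (suc j) * z^ (suc o)) ≈⟨ *-congˡ (sym (z^-+ (suc j) (suc o))) ⟩
    z^ (suc j ℕ.* r′) * z^ (suc j ℕ.+ suc o)      ≡⟨ ≡.cong (λ e → z^ (suc j ℕ.* r′) * z^ e) j+o≡k ⟩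
    z^ (suc j ℕ.* r′) * z^ (suc k)                ≈⟨ *-congˡ (sym eq) ⟩
    z^ (suc j ℕ.* r′) * z^ (suc j)                ≈⟨ *-comm _ _ ⟩
    z^ (suc j) * z^ (suc j ℕ.* r′)                ≈⟨ z^-inverse (suc j) ⟩
    1#                                            ∎)
    where
    j+o≡k : suc j ℕ.+ suc o ≡ suc k
    j+o≡k = ≡.trans (ℕ.+-suc (suc j) o) (≡.cong suc suc-j+o≡k)
    o<r : suc o < r
    o<r = ℕ.≤-<-trans (≡.subst (suc o ℕ.≤_) suc-j+o≡k (ℕ.s≤s (ℕ.m≤n+m o j))) k<r

  z^suc-injective : ∀ {j k} → j < r → k < r → z^ (suc j) ≈ z^ (suc k) → j ≡ k
  z^suc-injective {j} {k} j<r k<r eq with ℕ.<-cmp j k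
  ... | tri< j<k _ _ = ⊥-elim (z^suc-< j<k k<r eq)
  ... | tri≈ _ j≡k _ = j≡k
  ... | tri> _ _ k<j = ⊥-elim (z^suc-< k<j j<r (sym eq))

  z^a·x≈z^b·y⇔ : ∀ a b x y → (z^ a * x ≈ z^ b * y) ⇔ (x ≈ z^ (b ℕ.+ a ℕ.* r′) * y)
  z^a·x≈z^b·y⇔ a b x y = mk⇔
    (λ eq → begin
      x                          ≈⟨ sym (z^-cancelˡ a x) ⟩
      z^ (a ℕ.* r′) * (z^ a * x) ≈⟨ *-congˡ eq ⟩
      z^ (a ℕ.* r′) * (z^ b * y) ≈⟨ sym (*-assoc _ _ _) ⟩
      (z^ (a ℕ.* r′) * z^ b) * y ≈⟨ *-congʳ (trans (*-comm _ _) (sym (z^-+ b _))) ⟩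
      z^ (b ℕ.+ a ℕ.* r′) * y    ∎)
    (λ eq → begin
      z^ a * x                            ≈⟨ *-congˡ eq ⟩
      z^ a * (z^ (b ℕ.+ a ℕ.* r′) * y)    ≈⟨ *-congˡ (*-congʳ (trans (z^-+ b _) (*-comm _ _))) ⟩
      z^ a * ((z^ (a ℕ.* r′) * z^ b) * y) ≈⟨ *-congˡ (*-assoc _ _ _) ⟩
      z^ a * (z^ (a ℕ.* r′) * (z^ b * y)) ≈⟨ z^-cancelʳ a _ ⟩
      z^ b * y                            ∎)

  z^-*r′-cong : ∀ {a b} → z^ a ≈ z^ b → z^ (a ℕ.* r′) ≈ z^ (b ℕ.* r′)
  z^-*r′-cong {a} {b} z^a≈z^b = begin
    z^ (a ℕ.* r′)                          ≈⟨ sym (*-identityʳ _) ⟩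
    z^ (a ℕ.* r′) * 1#                     ≈⟨ *-congˡ (sym (z^-inverse b)) ⟩
    z^ (a ℕ.* r′) * (z^ b * z^ (b ℕ.* r′)) ≈⟨ *-congˡ (*-congʳ (sym z^a≈z^b)) ⟩
    z^ (a ℕ.* r′) * (z^ a * z^ (b ℕ.* r′)) ≈⟨ z^-cancelˡ a _ ⟩
    z^ (b ℕ.* r′)                          ∎

  z^-*r′-*r′ : ∀ e → z^ (e ℕ.* r′ ℕ.* r′) ≈ z^ e
  z^-*r′-*r′ e = begin
    z^ (e ℕ.* r′ ℕ.* r′)                          ≈⟨ sym (*-identityʳ _) ⟩
    z^ (e ℕ.* r′ ℕ.* r′) * 1#                     ≈⟨ *-congˡ (sym (trans (*-comm _ _) (z^-inverse e))) ⟩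
    z^ (e ℕ.* r′ ℕ.* r′) * (z^ (e ℕ.* r′) * z^ e) ≈⟨ sym (*-assoc _ _ _) ⟩
    (z^ (e ℕ.* r′ ℕ.* r′) * z^ (e ℕ.* r′)) * z^ e ≈⟨ *-congʳ (trans (*-comm _ _) (z^-inverse (e ℕ.* r′))) ⟩
    1# * z^ e                                     ≈⟨ *-identityˡ _ ⟩
    z^ e                                          ∎

  z^-shifts-cancel : ∀ e a b → z^ (e ℕ.+ a ℕ.+ b ℕ.* r′ ℕ.+ b ℕ.+ a ℕ.* r′) ≈ z^ e
  z^-shifts-cancel e a b = begin
    z^ (e ℕ.+ a ℕ.+ b ℕ.* r′ ℕ.+ b ℕ.+ a ℕ.* r′)
      ≈⟨ trans (z^-+ (e ℕ.+ a ℕ.+ b ℕ.* r′ ℕ.+ b) (a ℕ.* r′)) (*-congʳ (trans (z^-+ (e ℕ.+ a ℕ.+ b ℕ.* r′) b)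
           (*-congʳ (trans (z^-+ (e ℕ.+ a) (b ℕ.* r′)) (*-congʳ (z^-+ e a)))))) ⟩
    (((z^ e * z^ a) * z^ (b ℕ.* r′)) * z^ b) * z^ (a ℕ.* r′)
      ≈⟨ solve 5 (λ x y y′ w w′ → (((x :* y) :* w′) :* w) :* y′ := x :* ((y :* y′) :* (w :* w′))) refl
                 (z^ e) (z^ a) (z^ (a ℕ.* r′)) (z^ b) (z^ (b ℕ.* r′)) ⟩
    z^ e * ((z^ a * z^ (a ℕ.* r′)) * (z^ b * z^ (b ℕ.* r′)))
      ≈⟨ *-congˡ (trans (*-cong (z^-inverse a) (z^-inverse b)) (*-identityˡ 1#)) ⟩
    z^ e * 1#
      ≈⟨ *-identityʳ _ ⟩
    z^ e ∎

module CoordinateForms {c ℓ} (K : Field c ℓ) where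
  open import Data.Fin using (Fin)
  open import Data.Fin.Properties using (_≟_)
  open import Data.Empty using (⊥-elim)
  open import Relation.Nullary using (yes; no)
  open import Relation.Binary.PropositionalEquality as ≡ using (_≢_)
  open Field K
  open import Algebra.Properties.Ring ring using (-‿distribˡ-*)
  open LinearAlgebra K using (sumF-cong; sumF-+; sumF-*ˡ; sumF-single)
  open import Relation.Binary.Reasoning.Setoid setoid

  eval-coord : ∀ {n} (i : Fin n) (v : Vect K n) → eval K (coord K i) v ≈ v i
  eval-coord i v = trans (sumF-single (λ x → coord K i x * v x) i off-i) at-i
    where
    off-i : ∀ x → x ≢ i → coord K i x * v x ≈ 0#
    off-i x x≢i with x ≟ i
    ... | yes x≡i = ⊥-elim (x≢i x≡i)
    ... | no _    = zeroˡ _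
    at-i : coord K i i * v i ≈ v i
    at-i with i ≟ i
    ... | yes _  = *-identityˡ _
    ... | no i≢i = ⊥-elim (i≢i ≡.refl)

  eval-diffForm : ∀ {n} (z : Carrier) k {i j : Fin n} → i ≢ j → ∀ v →
                  eval K (diffForm K z k i j) v ≈ v i - pow K z k * v j
  eval-diffForm {n} z k {i} {j} i≢j v = begin
    sumF K (λ x → diffForm K z k i j x * v x)
      ≈⟨ sumF-cong (λ x → split x) ⟩
    sumF K (λ x → coord K i x * v x + - pow K z k * (coord K j x * v x))
      ≈⟨ sumF-+ {n} _ _ ⟩
    eval K (coord K i) v + sumF K (λ x → - pow K z k * (coord K j x * v x))
      ≈⟨ +-congˡ (sumF-*ˡ {n} _ _) ⟩
    eval K (coord K i) v + - pow K z k * eval K (coord K j) v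
      ≈⟨ +-cong (eval-coord i v) (*-congˡ (eval-coord j v)) ⟩
    v i + - pow K z k * v j
      ≈⟨ +-congˡ (sym (-‿distribˡ-* _ _)) ⟩
    v i - pow K z k * v j ∎
    where
    w+c·0≈w : ∀ {x} w → w + - pow K z k * (0# * v x) ≈ w
    w+c·0≈w w = trans (+-congˡ (trans (*-congˡ (zeroˡ _)) (zeroʳ _))) (+-identityʳ w)
    split : ∀ x → diffForm K z k i j x * v x ≈ coord K i x * v x + - pow K z k * (coord K j x * v x)
    split x with x ≟ i | x ≟ j
    ... | yes ≡.refl | yes ≡.refl = ⊥-elim (i≢j ≡.refl)
    ... | yes _ | no _  = sym (w+c·0≈w _)
    ... | no _  | yes _ = sym (trans (+-cong (zeroˡ _) (*-congˡ (*-identityˡ _))) (+-identityˡ _))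
    ... | no _  | no _  = sym (w+c·0≈w _)

module BooleanTests where
  open import Data.Bool using (Bool; true; false; _∧_; not)
  open import Data.Bool.Properties using (T-≡; ∧-identityʳ; ∧-zeroʳ)
  open import Data.Bool.ListAction using (any)
  open import Data.Product using (∃; _×_; _,_; proj₁; proj₂)
  open import Data.Empty using (⊥-elim)
  open import Data.List using (List)
  open import Data.List.Membership.Propositional using (_∈_; find; lose)
  open import Data.List.Relation.Unary.Any.Properties using (any⁺; any⁻)
  open import Function using (_∘_)
  open import Function.Bundles using (_⇔_; mk⇔; Equivalence)
  open import Relation.Nullary using (¬_; Dec; yes; no)
  open import Relation.Nullary.Decidable using (⌊_⌋)
  open import Relation.Binary.PropositionalEquality as ≡ using (_≡_)

  dec-∧ : ∀ {p} {P : Set p} (d : Dec P) b → (⌊ d ⌋ ∧ b ≡ true) ⇔ (P × b ≡ true)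
  dec-∧ (yes p) b = mk⇔ (p ,_) proj₂
  dec-∧ (no ¬p) b = mk⇔ (λ ()) (⊥-elim ∘ ¬p ∘ proj₁)

  ∧-dec : ∀ {p} {P : Set p} b (d : Dec P) → (b ∧ ⌊ d ⌋ ≡ true) ⇔ (b ≡ true × P)
  ∧-dec true  (yes p) = mk⇔ (λ _ → ≡.refl , p) (λ _ → ≡.refl)
  ∧-dec true  (no ¬p) = mk⇔ (λ ()) (⊥-elim ∘ ¬p ∘ proj₂)
  ∧-dec false d       = mk⇔ (λ ()) (λ ())

  not-dec-∧ : ∀ {p} {P : Set p} (d : Dec P) b → (not ⌊ d ⌋ ∧ b ≡ true) ⇔ (¬ P × b ≡ true)
  not-dec-∧ (yes p) b = mk⇔ (λ ()) (λ (¬p , _) → ⊥-elim (¬p p))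
  not-dec-∧ (no ¬p) b = mk⇔ (¬p ,_) proj₂

  ∧-not-dec : ∀ {p} {P : Set p} b (d : Dec P) → (b ∧ not ⌊ d ⌋ ≡ true) ⇔ (b ≡ true × ¬ P)
  ∧-not-dec b (yes p) rewrite ∧-zeroʳ b = mk⇔ (λ ()) (λ (_ , ¬p) → ⊥-elim (¬p p))
  ∧-not-dec b (no ¬p) = mk⇔ (λ eq → ≡.trans (≡.sym (∧-identityʳ b)) eq , ¬p) (λ (eq , _) → ≡.trans (∧-identityʳ b) eq)

  any≡true⇔ : ∀ {a} {A : Set a} (f : A → Bool) (xs : List A) → (any f xs ≡ true) ⇔ (∃ λ x → x ∈ xs × f x ≡ true)
  any≡true⇔ f xs = mk⇔
    (λ eq → let (x , x∈xs , Tfx) = find (any⁻ f xs (Equivalence.from T-≡ eq)) in x , x∈xs , Equivalence.to T-≡ Tfx)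
    (λ (x , x∈xs , fx≡true) → Equivalence.to T-≡ (any⁺ f (lose x∈xs (Equivalence.from T-≡ fx≡true))))

module GraphicArrangement {c ℓ} (K : Field c ℓ) (r : ℕ) (z : Field.Carrier K) where
  open import Data.Nat as ℕ using (_<_; _<?_)
  open import Data.Fin using (Fin; toℕ)
  open import Data.Bool using (true; _∧_; if_then_else_)
  open import Data.Product using (∃; ∃₂; _×_; _,_)
  open import Data.Sum using (_⊎_; inj₁; inj₂)
  open import Data.List using (List; []; map; concatMap; allFin; upTo)
  open import Data.List.Membership.Propositional using (_∈_; find; lose)
  open import Data.List.Membership.Propositional.Properties
    using (∈-++⁺ˡ; ∈-++⁺ʳ; ∈-++⁻; ∈-map⁺; ∈-map⁻; ∈-concatMap⁺; ∈-concatMap⁻; ∈-allFin; ∈-upTo⁺; ∈-upTo⁻)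
  open import Function.Bundles using (Equivalence)
  open import Relation.Binary.PropositionalEquality as ≡ using (_≡_)
  open import Relation.Nullary.Decidable using (⌊_⌋)
  open BooleanTests using (∧-dec)

  M : ∀ {n} → Adjacency n → List (Form K n)
  M H = graphicMonomial K H r z

  private
    formsOfPair : ∀ {n} → Adjacency n → Fin n → Fin n → List (Form K n)
    formsOfPair H i j =
      if (H i j ∧ ⌊ toℕ i <? toℕ j ⌋) then map (λ k → diffForm K z (suc k) i j) (upTo r) else []

    ∈-if⁻ : ∀ {a} {A : Set a} b {xs : List A} {x} → x ∈ (if b then xs else []) → b ≡ true × x ∈ xs
    ∈-if⁻ true x∈xs = ≡.refl , x∈xs

  IsEdgeForm : ∀ {n} → Adjacency n → Form K n → Set c
  IsEdgeForm {n} H α = ∃₂ λ (i j : Fin n) → ∃ λ k →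
    H i j ≡ true × toℕ i < toℕ j × k < r × α ≡ diffForm K z (suc k) i j

  ∈M⁻ : ∀ {n} (H : Adjacency n) {α} → α ∈ M H → IsEdgeForm H α ⊎ ∃ λ w → α ≡ coord K w
  ∈M⁻ {n} H α∈M with ∈-++⁻ (concatMap (λ i → concatMap (formsOfPair H i) (allFin n)) (allFin n)) α∈M
  ... | inj₂ α∈coords = let (w , _ , α≡) = ∈-map⁻ (coord K) α∈coords in inj₂ (w , α≡)
  ... | inj₁ α∈edges with find (∈-concatMap⁻ _ {xs = allFin n} α∈edges)
  ...   | i , _ , α∈i with find (∈-concatMap⁻ (formsOfPair H i) {xs = allFin n} α∈i)
  ...     | j , _ , α∈ij with ∈-if⁻ (H i j ∧ _) α∈ij
  ...       | guard , α∈diffs with ∈-map⁻ (λ k → diffForm K z (suc k) i j) α∈diffs | Equivalence.to (∧-dec (H i j) (toℕ i <? toℕ j)) guard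
  ...         | k , k∈upTo , α≡ | Hij , i<j = inj₁ (i , j , k , Hij , i<j , ∈-upTo⁻ k∈upTo , α≡)

  diffForm∈M : ∀ {n} (H : Adjacency n) {i j k} → H i j ≡ true → toℕ i < toℕ j → k < r →
               diffForm K z (suc k) i j ∈ M H
  diffForm∈M {n} H {i} {j} {k} Hij i<j k<r =
    ∈-++⁺ˡ (∈-concatMap⁺ _ (lose (∈-allFin i) (∈-concatMap⁺ (formsOfPair H i) (lose (∈-allFin j) ∈ij))))
    where
    ∈ij : diffForm K z (suc k) i j ∈ formsOfPair H i j
    ∈ij rewrite Equivalence.from (∧-dec (H i j) (toℕ i <? toℕ j)) (Hij , i<j) = ∈-map⁺ _ (∈-upTo⁺ k<r)

  coord∈M : ∀ {n} (H : Adjacency n) (w : Fin n) → coord K w ∈ M H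
  coord∈M {n} H w = ∈-++⁺ʳ _ (∈-map⁺ (coord K) (∈-allFin w))

module EdgeOperations {m : ℕ} (i₁ i₂ : Fin (suc m)) (i₁≢i₂ : i₁ ≢ i₂) where
  open import Data.Fin using (punchIn; punchOut)
  open import Data.Fin.Properties using (_≟_; punchInᵢ≢i; punchOut-punchIn; punchIn-punchOut; punchOut-injective; punchOut-cong)
  open import Data.Bool using (true; _∧_; _∨_; not)
  open import Data.Product using (∃₂; _×_; _,_)
  open import Data.Sum using (_⊎_; inj₁; inj₂)
  open import Data.Empty using (⊥-elim)
  open import Data.List using (allFin)
  open import Data.List.Membership.Propositional.Properties using (∈-allFin)
  open import Function using (_∘′_)
  open import Function.Bundles using (_⇔_; mk⇔; Equivalence)
  open import Relation.Nullary using (¬_; Dec; yes; no)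
  open import Relation.Nullary.Decidable using (_×-dec_; _⊎-dec_; ⌊_⌋; isYes≗does)
  open import Relation.Binary.PropositionalEquality as ≡ using (_≡_; _≢_; refl; sym; trans; cong)
  open BooleanTests using (∧-not-dec; not-dec-∧; dec-∧; any≡true⇔)

  π : Fin (suc m) → Fin m
  π = mergeMap i₁ i₂ i₁≢i₂

  π-punchOut : ∀ {w} (i₂≢w : i₂ ≢ w) → π w ≡ punchOut i₂≢w
  π-punchOut {w} i₂≢w with i₂ ≟ w
  ... | yes i₂≡w = ⊥-elim (i₂≢w i₂≡w)
  ... | no _     = punchOut-cong i₂ refl

  π-i₂ : π i₂ ≡ π i₁
  π-i₂ with i₂ ≟ i₂
  ... | yes _    = sym (trans (π-punchOut (i₁≢i₂ ∘′ sym)) (punchOut-cong i₂ refl))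
  ... | no i₂≢i₂ = ⊥-elim (i₂≢i₂ refl)

  π-punchIn : ∀ c → π (punchIn i₂ c) ≡ c
  π-punchIn c = trans (π-punchOut (λ i₂≡ → punchInᵢ≢i i₂ c (sym i₂≡))) (trans (punchOut-cong i₂ refl) (punchOut-punchIn i₂))

  punchIn-π : ∀ {w} → i₂ ≢ w → punchIn i₂ (π w) ≡ w
  punchIn-π i₂≢w = trans (cong (punchIn i₂) (π-punchOut i₂≢w)) (punchIn-punchOut i₂≢w)

  π-fibre-i₁ : ∀ {w} → π w ≡ π i₁ → w ≡ i₁ ⊎ w ≡ i₂
  π-fibre-i₁ {w} πw≡πi₁ = byCase (i₂ ≟ w)
    where
    i₂≢i₁ : i₂ ≢ i₁
    i₂≢i₁ e = i₁≢i₂ (sym e)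
    byCase : Dec (i₂ ≡ w) → w ≡ i₁ ⊎ w ≡ i₂
    byCase (yes i₂≡w) = inj₂ (sym i₂≡w)
    byCase (no i₂≢w)  = inj₁ (punchOut-injective i₂≢w i₂≢i₁
      (trans (sym (π-punchOut i₂≢w)) (trans πw≡πi₁ (π-punchOut i₂≢i₁))))

  IsEdge : Fin (suc m) → Fin (suc m) → Set
  IsEdge p q = (p ≡ i₁ × q ≡ i₂) ⊎ (p ≡ i₂ × q ≡ i₁)

  isEdge? : ∀ p q → Dec (IsEdge p q)
  isEdge? p q = (p ≟ i₁ ×-dec q ≟ i₂) ⊎-dec (p ≟ i₂ ×-dec q ≟ i₁)

  IsEdge-sym : ∀ {p q} → IsEdge p q → IsEdge q p
  IsEdge-sym (inj₁ (p≡ , q≡)) = inj₂ (q≡ , p≡)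
  IsEdge-sym (inj₂ (p≡ , q≡)) = inj₁ (q≡ , p≡)

  IsEdge-unique : ∀ {p q p′ q′} → IsEdge p q → IsEdge p′ q′ → (p ≡ p′ × q ≡ q′) ⊎ (p ≡ q′ × q ≡ p′)
  IsEdge-unique (inj₁ (refl , refl)) (inj₁ (refl , refl)) = inj₁ (refl , refl)
  IsEdge-unique (inj₁ (refl , refl)) (inj₂ (refl , refl)) = inj₂ (refl , refl)
  IsEdge-unique (inj₂ (refl , refl)) (inj₁ (refl , refl)) = inj₂ (refl , refl)
  IsEdge-unique (inj₂ (refl , refl)) (inj₂ (refl , refl)) = inj₁ (refl , refl)

  IsEdge⇒π≡ : ∀ {p q} → IsEdge p q → π p ≡ π q
  IsEdge⇒π≡ (inj₁ (refl , refl)) = sym π-i₂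
  IsEdge⇒π≡ (inj₂ (refl , refl)) = π-i₂

  π≡⇒IsEdge : ∀ {p q} → π p ≡ π q → p ≢ q → IsEdge p q
  π≡⇒IsEdge {p} {q} πp≡πq p≢q = byCase (i₂ ≟ p) (i₂ ≟ q)
    where
    byCase : Dec (i₂ ≡ p) → Dec (i₂ ≡ q) → IsEdge p q
    byCase (yes i₂≡p) (yes i₂≡q) = ⊥-elim (p≢q (trans (sym i₂≡p) i₂≡q))
    byCase (yes i₂≡p) (no i₂≢q) with π-fibre-i₁ (trans (sym πp≡πq) (trans (cong π (sym i₂≡p)) π-i₂))
    ... | inj₁ q≡i₁ = inj₂ (sym i₂≡p , q≡i₁)
    ... | inj₂ q≡i₂ = ⊥-elim (i₂≢q (sym q≡i₂))
    byCase (no i₂≢p) (yes i₂≡q) with π-fibre-i₁ (trans πp≡πq (trans (cong π (sym i₂≡q)) π-i₂))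
    ... | inj₁ p≡i₁ = inj₁ (p≡i₁ , sym i₂≡q)
    ... | inj₂ p≡i₂ = ⊥-elim (i₂≢p (sym p≡i₂))
    byCase (no i₂≢p) (no i₂≢q) =
      ⊥-elim (p≢q (punchOut-injective i₂≢p i₂≢q (trans (sym (π-punchOut i₂≢p)) (trans πp≡πq (π-punchOut i₂≢q)))))

  deleteEdge≡true⇔ : ∀ (G : Adjacency (suc m)) p q → (deleteEdge G i₁ i₂ p q ≡ true) ⇔ (G p q ≡ true × ¬ IsEdge p q)
  deleteEdge≡true⇔ G p q =
    ≡.subst (λ b → (G p q ∧ not b ≡ true) ⇔ (G p q ≡ true × ¬ IsEdge p q)) ⌊isEdge?⌋ (∧-not-dec (G p q) (isEdge? p q))
    where
    ⌊isEdge?⌋ : ⌊ isEdge? p q ⌋ ≡ (⌊ p ≟ i₁ ⌋ ∧ ⌊ q ≟ i₂ ⌋) ∨ (⌊ p ≟ i₂ ⌋ ∧ ⌊ q ≟ i₁ ⌋)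
    ⌊isEdge?⌋ = trans (isYes≗does (isEdge? p q))
      (sym (≡.cong₂ _∨_ (≡.cong₂ _∧_ (isYes≗does (p ≟ i₁)) (isYes≗does (q ≟ i₂)))
                        (≡.cong₂ _∧_ (isYes≗does (p ≟ i₂)) (isYes≗does (q ≟ i₁)))))

  contractEdge≡true⇔ : ∀ (G : Adjacency (suc m)) c d → (contractEdge G i₁ i₂ i₁≢i₂ c d ≡ true) ⇔
    (c ≢ d × ∃₂ λ p q → π p ≡ c × π q ≡ d × G p q ≡ true)
  contractEdge≡true⇔ G c d = mk⇔ to from
    where
    to : contractEdge G i₁ i₂ i₁≢i₂ c d ≡ true → c ≢ d × ∃₂ λ p q → π p ≡ c × π q ≡ d × G p q ≡ true
    to eq with Equivalence.to (not-dec-∧ (c ≟ d) _) eq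
    ... | c≢d , any-p with Equivalence.to (any≡true⇔ _ (allFin (suc m))) any-p
    ...   | p , _ , any-q with Equivalence.to (any≡true⇔ _ (allFin (suc m))) any-q
    ...     | q , _ , πp≡c∧πq≡d∧Gpq with Equivalence.to (dec-∧ (π p ≟ c) _) πp≡c∧πq≡d∧Gpq
    ...       | πp≡c , πq≡d∧Gpq with Equivalence.to (dec-∧ (π q ≟ d) _) πq≡d∧Gpq
    ...         | πq≡d , Gpq = c≢d , p , q , πp≡c , πq≡d , Gpq
    from : c ≢ d × ∃₂ (λ p q → π p ≡ c × π q ≡ d × G p q ≡ true) → contractEdge G i₁ i₂ i₁≢i₂ c d ≡ true
    from (c≢d , p , q , πp≡c , πq≡d , Gpq) = Equivalence.from (not-dec-∧ (c ≟ d) _) (c≢d ,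
      Equivalence.from (any≡true⇔ _ (allFin (suc m))) (p , ∈-allFin p ,
        Equivalence.from (any≡true⇔ _ (allFin (suc m))) (q , ∈-allFin q ,
          Equivalence.from (dec-∧ (π p ≟ c) _) (πp≡c , Equivalence.from (dec-∧ (π q ≟ d) _) (πq≡d , Gpq)))))

module RatioHyperplanes {c ℓ} (K : Field c ℓ) (r′ : ℕ) (z : Field.Carrier K) (isPrimitive : IsPrimitiveRoot K (suc r′) z) where
  import Data.Nat as ℕ
  import Data.Nat.Properties as ℕ
  open import Data.Fin using (toℕ)
  open import Data.Fin.Properties using (toℕ-injective)
  open import Data.Bool using (true)
  open import Data.Product using (∃; _×_; _,_)
  open import Data.Empty using (⊥-elim)
  open import Data.List.Membership.Propositional using (_∈_)
  open import Relation.Binary.Definitions using (tri<; tri≈; tri>)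
  open import Level using (_⊔_)
  open import Function using (_∘′_)
  open import Relation.Binary.PropositionalEquality as ≡ using (_≡_)
  open import Function.Bundles using (_⇔_; mk⇔; Equivalence)
  open import Function.Construct.Composition using (_⇔-∘_)
  open import Function.Construct.Symmetry using (⇔-sym)
  open Field K
  open RootOfUnity K r′ z isPrimitive
  open CoordinateForms K using (eval-coord; eval-diffForm)
  open GraphicArrangement K r z using (M; diffForm∈M)
  open import Algebra.Properties.AbelianGroup +-abelianGroup using (x∙y⁻¹≈ε⇒x≈y; x≈y⇒x∙y⁻¹≈ε)

  -- A record rather than a function type, so that Agda can infer e by unification although z^_ is not injective.
  record CutsOutRatio {n} (g : Vect K n → Carrier) (i j : Fin n) (e : ℕ) : Set (c ⊔ ℓ) where
    constructor cutsOutRatio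
    field ratio⇔ : ∀ u → (g u ≈ 0#) ⇔ (u i ≈ z^ e * u j)

  record CutsOutZero {n} (g : Vect K n → Carrier) (i : Fin n) : Set (c ⊔ ℓ) where
    constructor cutsOutZero
    field zero⇔ : ∀ u → (g u ≈ 0#) ⇔ (u i ≈ 0#)

  open CutsOutRatio public
  open CutsOutZero public

  CutsOutRatio-z^ : ∀ {n} {g : Vect K n → Carrier} {i j e e′} → z^ e ≈ z^ e′ → CutsOutRatio g i j e → CutsOutRatio g i j e′
  CutsOutRatio-z^ z^e≈z^e′ (cutsOutRatio g⇔) = cutsOutRatio λ u →
    mk⇔ (λ gu≈0 → trans (Equivalence.to (g⇔ u) gu≈0) (*-congʳ z^e≈z^e′))
        (λ ui≈ → Equivalence.from (g⇔ u) (trans ui≈ (*-congʳ (sym z^e≈z^e′))))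

  CutsOutRatio-flip : ∀ {n} {g : Vect K n → Carrier} {i j e} → CutsOutRatio g i j e → CutsOutRatio g j i (e ℕ.* r′)
  CutsOutRatio-flip {e = e} (cutsOutRatio g⇔) = cutsOutRatio λ u → mk⇔
    (λ gu≈0 → sym (trans (*-congˡ (Equivalence.to (g⇔ u) gu≈0)) (z^-cancelˡ e _)))
    (λ uj≈ → Equivalence.from (g⇔ u) (sym (trans (*-congˡ uj≈) (z^-cancelʳ e _))))

  sameRatio : ∀ {n} {g h : Vect K n → Carrier} {i j e} → CutsOutRatio g i j e → CutsOutRatio h i j e →
              ∀ u → (g u ≈ 0#) ⇔ (h u ≈ 0#)
  sameRatio g↔ h↔ u = ⇔-sym (ratio⇔ h↔ u) ⇔-∘ ratio⇔ g↔ u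

  sameZero : ∀ {n} {g h : Vect K n → Carrier} {i} → CutsOutZero g i → CutsOutZero h i →
             ∀ u → (g u ≈ 0#) ⇔ (h u ≈ 0#)
  sameZero g↔ h↔ u = ⇔-sym (zero⇔ h↔ u) ⇔-∘ zero⇔ g↔ u

  coord-cutsOutZero : ∀ {n} (i : Fin n) → CutsOutZero (eval K (coord K i)) i
  coord-cutsOutZero i = cutsOutZero λ u → mk⇔ (trans (sym (eval-coord i u))) (trans (eval-coord i u))

  diffForm-cutsOutRatio : ∀ {n} {i j : Fin n} → i ≢ j → ∀ e → CutsOutRatio (eval K (diffForm K z e i j)) i j e
  diffForm-cutsOutRatio i≢j e = cutsOutRatio λ u → mk⇔
    (λ eq → x∙y⁻¹≈ε⇒x≈y _ _ (trans (sym (eval-diffForm z e i≢j u)) eq))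
    (λ eq → trans (eval-diffForm z e i≢j u) (x≈y⇒x∙y⁻¹≈ε eq))

  ratio∈M : ∀ {n} (H : Adjacency n) {c d} → H c d ≡ true → H d c ≡ true → c ≢ d → ∀ e →
            ∃ λ β → β ∈ M H × CutsOutRatio (eval K β) c d e
  ratio∈M H {c} {d} Hcd Hdc c≢d e with ℕ.<-cmp (toℕ c) (toℕ d)
  ... | tri< c<d _ _ = let (j , j<r , z^j≈z^e) = z^-as-z^suc e in
    diffForm K z (suc j) c d , diffForm∈M H Hcd c<d j<r ,
    CutsOutRatio-z^ z^j≈z^e (diffForm-cutsOutRatio c≢d (suc j))
  ... | tri≈ _ c≡d _ = ⊥-elim (c≢d (toℕ-injective c≡d))
  ... | tri> _ _ d<c = let (j , j<r , z^j≈z^er′) = z^-as-z^suc (e ℕ.* r′) in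
    diffForm K z (suc j) d c , diffForm∈M H Hdc d<c j<r ,
    CutsOutRatio-z^ (trans (z^-*r′-cong {suc j} {e ℕ.* r′} z^j≈z^er′) (z^-*r′-*r′ e)) (CutsOutRatio-flip (diffForm-cutsOutRatio (c≢d ∘′ ≡.sym) (suc j)))

module DeletionContraction {c ℓ} (K : Field c ℓ) (r′ : ℕ) (z : Field.Carrier K) (isPrimitive : IsPrimitiveRoot K (suc r′) z)
  {m : ℕ} (G : Adjacency (suc m)) (simple : IsSimpleGraph G)
  (i₁ i₂ : Fin (suc m)) (G-i₁i₂ : G i₁ i₂ ≡ true) (i₁≢i₂ : i₁ ≢ i₂)
  (dim : List (Form K (suc m)) → ℕ) (isDim : IsDimFun K dim)
  (dim′ : List (Form K m) → ℕ) (isDim′ : IsDimFun K dim′) (t : ℤ) where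
  open import Data.Nat as ℕ using (_<_)
  import Data.Nat.Properties as ℕ
  open import Data.Fin using (toℕ; punchIn)
  open import Data.Fin.Properties using (_≟_; toℕ-injective)
  open import Data.Bool using (true; if_then_else_)
  open import Data.Product using (∃; ∃₂; _×_; _,_; proj₁; proj₂)
  open import Data.Sum using (inj₁; inj₂)
  open import Data.Empty using (⊥-elim)
  open import Data.List using ([]; _∷_; _++_; map; upTo; length)
  open import Data.List.Membership.Propositional using (_∈_)
  open import Data.List.Membership.Propositional.Properties using (∈-++⁺ˡ; ∈-++⁺ʳ; ∈-++⁻; ∈-map⁺; ∈-map⁻; ∈-upTo⁺; ∈-upTo⁻)
  open import Relation.Nullary using (¬_; Dec; yes; no)
  open import Relation.Nullary.Decidable using (⌊_⌋)
  open import Relation.Binary.Definitions using (tri<; tri≈; tri>)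
  open import Relation.Binary.PropositionalEquality as ≡ using (_≡_; refl)
  open import Function using (_∘′_)
  open import Data.Integer as ℤ using (+_)
  import Data.Integer.Properties as ℤ
  open import Data.Integer.Tactic.RingSolver using (solve-∀)
  open import Data.List.Properties using (length-upTo)
  open import Data.List.Relation.Unary.All as All using (All; []; _∷_)
  open import Data.List.Relation.Unary.Unique.Propositional using (Unique; []; _∷_)
  open import Data.List.Relation.Unary.Unique.Propositional.Properties using (upTo⁺)
  open import Function.Bundles using (mk⇔; Equivalence)
  open Field K hiding (refl) renaming (sym to ≈-sym; trans to ≈-trans; reflexive to ≈-reflexive)
  open import Algebra.Properties.Ring ring using ([y-z]x≈yx-zx)
  open import Algebra.Properties.AbelianGroup +-abelianGroup using (x∙y⁻¹≈ε⇒x≈y; x≈y⇒x∙y⁻¹≈ε)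
  open RootOfUnity K r′ z isPrimitive
  open RatioHyperplanes K r′ z isPrimitive
  open GraphicArrangement K r z
  open EdgeOperations i₁ i₂ i₁≢i₂
  open LinearAlgebra K using (InjectiveLinearMap; MapsOnto; sumF-cong; sumF-*ˡ; x≉0∧xy≈0⇒y≈0)
  open CoordinateForms K using (eval-coord; eval-diffForm)
  module χₙ = Restriction K dim isDim t
  module χₘ = Restriction K dim′ isDim′ t

  private
    n : ℕ
    n = suc m

  D : Adjacency n
  D = deleteEdge G i₁ i₂

  C : Adjacency m
  C = contractEdge G i₁ i₂ i₁≢i₂

  D⇒G : ∀ {p q} → D p q ≡ true → G p q ≡ true
  D⇒G {p} {q} = proj₁ ∘′ Equivalence.to (deleteEdge≡true⇔ G p q)

  D⇒¬IsEdge : ∀ {p q} → D p q ≡ true → ¬ IsEdge p q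
  D⇒¬IsEdge {p} {q} = proj₂ ∘′ Equivalence.to (deleteEdge≡true⇔ G p q)

  G∧¬IsEdge⇒D : ∀ {p q} → G p q ≡ true → ¬ IsEdge p q → D p q ≡ true
  G∧¬IsEdge⇒D {p} {q} Gpq ¬pq = Equivalence.from (deleteEdge≡true⇔ G p q) (Gpq , ¬pq)

  G-sym : ∀ {p q} → G p q ≡ true → G q p ≡ true
  G-sym {p} {q} = ≡.trans (proj₁ simple q p)

  D-sym : ∀ {p q} → D p q ≡ true → D q p ≡ true
  D-sym Dpq = G∧¬IsEdge⇒D (G-sym (D⇒G Dpq)) (D⇒¬IsEdge Dpq ∘′ IsEdge-sym)

  C-sym : ∀ {c d} → C c d ≡ true → C d c ≡ true
  C-sym {c} {d} Ccd with Equivalence.to (contractEdge≡true⇔ G c d) Ccd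
  ... | c≢d , p , q , πp≡c , πq≡d , Gpq =
    Equivalence.from (contractEdge≡true⇔ G d c) (c≢d ∘′ ≡.sym , q , p , πq≡d , πp≡c , G-sym Gpq)

  -- the deleted edge {a , b}, oriented so that a < b as in the definition of M
  orientation : ∃₂ λ a b → IsEdge a b × toℕ a < toℕ b
  orientation with ℕ.<-cmp (toℕ i₁) (toℕ i₂)
  ... | tri< i₁<i₂ _ _ = i₁ , i₂ , inj₁ (refl , refl) , i₁<i₂
  ... | tri≈ _ i₁≡i₂ _ = ⊥-elim (i₁≢i₂ (toℕ-injective i₁≡i₂))
  ... | tri> _ _ i₂<i₁ = i₂ , i₁ , inj₂ (refl , refl) , i₂<i₁

  a b : Fin n
  a = proj₁ orientation
  b = proj₁ (proj₂ orientation)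

  IsEdge-ab : IsEdge a b
  IsEdge-ab = proj₁ (proj₂ (proj₂ orientation))

  a<b : toℕ a < toℕ b
  a<b = proj₂ (proj₂ (proj₂ orientation))

  a≢b : a ≢ b
  a≢b a≡b = ℕ.<-irrefl (≡.cong toℕ a≡b) a<b

  G-ab : G a b ≡ true
  G-ab with IsEdge-ab
  ... | inj₁ (a≡i₁ , b≡i₂) = ≡.subst₂ (λ p q → G p q ≡ true) (≡.sym a≡i₁) (≡.sym b≡i₂) G-i₁i₂
  ... | inj₂ (a≡i₂ , b≡i₁) = ≡.subst₂ (λ p q → G p q ≡ true) (≡.sym a≡i₂) (≡.sym b≡i₁) (G-sym G-i₁i₂)

  IsEdge-oriented : ∀ {p q} → IsEdge p q → toℕ p < toℕ q → p ≡ a × q ≡ b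
  IsEdge-oriented pq p<q with IsEdge-unique pq IsEdge-ab
  ... | inj₁ p≡a×q≡b   = p≡a×q≡b
  ... | inj₂ (refl , refl) = ⊥-elim (ℕ.<-asym p<q a<b)

  π-i₂≡π-a : π i₂ ≡ π a
  π-i₂≡π-a with IsEdge-ab
  ... | inj₁ (a≡i₁ , _) = ≡.trans π-i₂ (≡.cong π (≡.sym a≡i₁))
  ... | inj₂ (a≡i₂ , _) = ≡.cong π (≡.sym a≡i₂)

  π-fibre-a-≢ : ∀ {w} → π w ≡ π a → w ≢ a → w ≡ b
  π-fibre-a-≢ πw≡πa w≢a with IsEdge-unique (π≡⇒IsEdge πw≡πa w≢a) IsEdge-ab
  ... | inj₁ (w≡a , _) = ⊥-elim (w≢a w≡a)
  ... | inj₂ (w≡b , _) = w≡b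

  edgeForm : ℕ → Form K n
  edgeForm k = diffForm K z (suc k) a b

  edgeForm-ratio : ∀ k → CutsOutRatio (eval K (edgeForm k)) a b (suc k)
  edgeForm-ratio k = diffForm-cutsOutRatio a≢b (suc k)

  edgeForms : List (Form K n)
  edgeForms = map edgeForm (upTo r)

  M-G⊆ : ∀ {α} → α ∈ M G → α ∈ edgeForms ++ M D
  M-G⊆ α∈ with ∈M⁻ G α∈
  ... | inj₂ (w , refl) = ∈-++⁺ʳ edgeForms (coord∈M D w)
  ... | inj₁ (p , q , k , Gpq , p<q , k<r , refl) with isEdge? p q
  ...   | no ¬pq = ∈-++⁺ʳ edgeForms (diffForm∈M D (G∧¬IsEdge⇒D Gpq ¬pq) p<q k<r)
  ...   | yes pq with IsEdge-oriented pq p<q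
  ...     | refl , refl = ∈-++⁺ˡ (∈-map⁺ edgeForm (∈-upTo⁺ k<r))

  ⊆M-G : ∀ {α} → α ∈ edgeForms ++ M D → α ∈ M G
  ⊆M-G α∈ with ∈-++⁻ edgeForms α∈
  ... | inj₁ α∈E with ∈-map⁻ edgeForm {xs = upTo r} α∈E
  ...   | k , k∈upTo , refl = diffForm∈M G G-ab a<b (∈-upTo⁻ k∈upTo)
  ⊆M-G α∈ | inj₂ α∈MD with ∈M⁻ D α∈MD
  ... | inj₂ (w , refl) = coord∈M G w
  ... | inj₁ (p , q , k , Dpq , p<q , k<r , refl) = diffForm∈M G (D⇒G Dpq) p<q k<r

  χ-deletion : χₙ.χ-on [] (M G) ≡ χₙ.χ-on [] (edgeForms ++ M D)
  χ-deletion = χₙ.χ-on-absorbed [] (M G) (edgeForms ++ M D)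
    (λ α∈ → _ , M-G⊆ α∈ , λ _ _ αv≈0 → αv≈0) (λ α∈ → _ , ⊆M-G α∈ , λ _ _ αv≈0 → αv≈0)

  -- The hyperplane x_a = z^(k+1) x_b, parametrised by K^m through φ.
  module RestrictionToEdgeForm (k : ℕ) where
    shift : Fin n → ℕ
    shift w = if ⌊ w ≟ a ⌋ then suc k else 0

    shift-a : shift a ≡ suc k
    shift-a with a ≟ a
    ... | yes _  = refl
    ... | no a≢a = ⊥-elim (a≢a refl)

    shift-≢a : ∀ {w} → w ≢ a → shift w ≡ 0
    shift-≢a {w} w≢a with w ≟ a
    ... | yes w≡a = ⊥-elim (w≢a w≡a)
    ... | no _    = refl

    φ : Vect K m → Vect K n
    φ u w = z^ (shift w) * u (π w)

    φ-map : InjectiveLinearMap m n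
    φ-map = record
      { apply      = φ
      ; apply-cong = λ u≋u′ w → *-congˡ (u≋u′ (π w))
      ; linear     = λ {k′} γ u w → ≈-trans (≈-sym (sumF-*ˡ {k′} (z^ (shift w)) _))
                       (sumF-cong {k′} (λ i → ≈-trans (≈-sym (*-assoc _ _ _)) (≈-trans (*-congʳ (*-comm _ _)) (*-assoc _ _ _))))
      ; injective  = λ u φu≋0 c → ≡.subst (λ c′ → u c′ ≈ 0#) (π-punchIn c)
                       (x≉0∧xy≈0⇒y≈0 (z^≉0 (shift (punchIn i₂ c))) (φu≋0 (punchIn i₂ c)))
      }

    pullback-zero : ∀ {g : Vect K n → Carrier} {w} → CutsOutZero g w → CutsOutZero (λ u → g (φ u)) (π w)
    pullback-zero {w = w} (cutsOutZero g⇔) = cutsOutZero λ u → mk⇔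
      (λ gφu≈0 → x≉0∧xy≈0⇒y≈0 (z^≉0 (shift w)) (Equivalence.to (g⇔ (φ u)) gφu≈0))
      (λ uπw≈0 → Equivalence.from (g⇔ (φ u)) (≈-trans (*-congˡ uπw≈0) (zeroʳ _)))

    pullback-ratio : ∀ {g : Vect K n → Carrier} {p q e} → CutsOutRatio g p q e →
                     CutsOutRatio (λ u → g (φ u)) (π p) (π q) (e ℕ.+ shift q ℕ.+ shift p ℕ.* r′)
    pullback-ratio {p = p} {q} {e} (cutsOutRatio g⇔) = cutsOutRatio λ u → mk⇔
      (λ gφu≈0 → Equivalence.to (z^a·x≈z^b·y⇔ (shift p) (e ℕ.+ shift q) _ _)
                   (≈-trans (Equivalence.to (g⇔ (φ u)) gφu≈0) (regroup u)))
      (λ uπp≈ → Equivalence.from (g⇔ (φ u))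
                   (≈-trans (Equivalence.from (z^a·x≈z^b·y⇔ (shift p) (e ℕ.+ shift q) _ _) uπp≈) (≈-sym (regroup u))))
      where
      regroup : ∀ u → z^ e * (z^ (shift q) * u (π q)) ≈ z^ (e ℕ.+ shift q) * u (π q)
      regroup u = ≈-trans (≈-sym (*-assoc _ _ _)) (*-congʳ (≈-sym (z^-+ e (shift q))))

    -- a section of φ on the hyperplane, sending the merged vertex back to b
    τ : Fin m → Fin n
    τ c with c ≟ π a
    ... | yes _ = b
    ... | no _  = punchIn i₂ c

    τ-πa : τ (π a) ≡ b
    τ-πa with π a ≟ π a
    ... | yes _    = refl
    ... | no πa≢πa = ⊥-elim (πa≢πa refl)

    τ-π : ∀ {w} → w ≢ a → τ (π w) ≡ w
    τ-π {w} w≢a with π w ≟ π a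
    ... | yes πw≡πa = ≡.sym (π-fibre-a-≢ πw≡πa w≢a)
    ... | no πw≢πa  = punchIn-π (λ i₂≡w → πw≢πa (≡.trans (≡.cong π (≡.sym i₂≡w)) π-i₂≡π-a))

    φ-onto : MapsOnto φ-map [] (edgeForm k ∷ [])
    φ-onto = onto , into
      where
      onto : ∀ v → InKer K (edgeForm k ∷ []) v → ∃ λ u → InKer K [] u × (∀ w → v w ≈ φ u w)
      onto v (edgeForm-v≈0 , _) = (λ c → v (τ c)) , _ , v≈φu
        where
        v≈φu : ∀ w → v w ≈ z^ (shift w) * v (τ (π w))
        v≈φu w = byCase (w ≟ a)
          where
          byCase : Dec (w ≡ a) → v w ≈ z^ (shift w) * v (τ (π w))
          byCase (yes w≡a) = ≡.subst (λ x → v x ≈ z^ (shift x) * v (τ (π x))) (≡.sym w≡a)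
            (≈-trans (Equivalence.to (ratio⇔ (edgeForm-ratio k) v) edgeForm-v≈0)
                     (≈-sym (*-cong (z^-cong shift-a) (≈-reflexive (≡.cong v τ-πa)))))
          byCase (no w≢a)  = ≈-sym (≈-trans (*-congʳ (z^-cong (shift-≢a w≢a)))
                                            (≈-trans (*-identityˡ _) (≈-reflexive (≡.cong v (τ-π w≢a)))))
      into : ∀ u → InKer K [] u → InKer K (edgeForm k ∷ []) (φ u)
      into u _ = Equivalence.from (ratio⇔ (edgeForm-ratio k) (φ u)) (≈-trans (*-congʳ (z^-cong shift-a)) (*-congˡ φub≈)) , _
        where
        φub≈ : u (π a) ≈ z^ (shift b) * u (π b)
        φub≈ = ≈-sym (≈-trans (*-congʳ (z^-cong (shift-≢a (a≢b ∘′ ≡.sym))))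
                              (≈-trans (*-identityˡ _) (≈-reflexive (≡.cong u (IsEdge⇒π≡ (IsEdge-sym IsEdge-ab))))))

    open Transport K dim isDim dim′ isDim′ t φ-map using (PullsBackTo; χ-on-transport)

    M-D→M-C : ∀ {α} → α ∈ M D → ∃ λ β → β ∈ M C × PullsBackTo α β
    M-D→M-C α∈ with ∈M⁻ D α∈
    ... | inj₂ (w , refl) = coord K (π w) , coord∈M C (π w) ,
                            sameZero (pullback-zero (coord-cutsOutZero w)) (coord-cutsOutZero (π w))
    ... | inj₁ (p , q , j , Dpq , p<q , _ , refl) =
      let (β , β∈ , β-ratio) = ratio∈M C C-πpπq (C-sym C-πpπq) πp≢πq _ in
      β , β∈ , sameRatio (pullback-ratio (diffForm-cutsOutRatio p≢q (suc j))) β-ratio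
      where
      p≢q : p ≢ q
      p≢q p≡q = ℕ.<-irrefl (≡.cong toℕ p≡q) p<q
      πp≢πq : π p ≢ π q
      πp≢πq πp≡πq = D⇒¬IsEdge Dpq (π≡⇒IsEdge πp≡πq p≢q)
      C-πpπq : C (π p) (π q) ≡ true
      C-πpπq = Equivalence.from (contractEdge≡true⇔ G (π p) (π q)) (πp≢πq , p , q , refl , refl , D⇒G Dpq)

    M-C→M-D : ∀ {β} → β ∈ M C → ∃ λ α → α ∈ M D × PullsBackTo α β
    M-C→M-D β∈ with ∈M⁻ C β∈
    ... | inj₂ (c , refl) = coord K (punchIn i₂ c) , coord∈M D (punchIn i₂ c) ,
      sameZero (≡.subst (CutsOutZero _) (π-punchIn c) (pullback-zero (coord-cutsOutZero (punchIn i₂ c)))) (coord-cutsOutZero c)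
    ... | inj₁ (c , d , j , Ccd , c<d , _ , refl) with Equivalence.to (contractEdge≡true⇔ G c d) Ccd
    ...   | c≢d , p , q , refl , refl , Gpq =
      let (α , α∈ , α-ratio) = ratio∈M D D-pq (D-sym D-pq) p≢q (suc j ℕ.+ shift p ℕ.+ shift q ℕ.* r′) in
      α , α∈ , sameRatio (CutsOutRatio-z^ (z^-shifts-cancel (suc j) (shift p) (shift q)) (pullback-ratio α-ratio))
                         (diffForm-cutsOutRatio c≢d (suc j))
      where
      p≢q : p ≢ q
      p≢q p≡q = c≢d (≡.cong π p≡q)
      D-pq : D p q ≡ true
      D-pq = G∧¬IsEdge⇒D Gpq (c≢d ∘′ IsEdge⇒π≡)

    χ-on-edgeForm : χₙ.χ-on (edgeForm k ∷ []) (M D) ≡ χₘ.χ-on [] (M C)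
    χ-on-edgeForm = χ-on-transport (M D) (M C) φ-onto M-D→M-C M-C→M-D

  open RestrictionToEdgeForm using (χ-on-edgeForm)

  edgeForms-meet-in-x_b≈0 : ∀ {j k} → j < r → k < r → j ≢ k → ∀ v →
    eval K (edgeForm k) v ≈ 0# → eval K (edgeForm j) v ≈ 0# → v b ≈ 0#
  edgeForms-meet-in-x_b≈0 {j} {k} j<r k<r j≢k v edgeForm-k≈0 edgeForm-j≈0 =
    x≉0∧xy≈0⇒y≈0 z^k-z^j≉0 (begin
      (z^ (suc k) - z^ (suc j)) * v b    ≈⟨ [y-z]x≈yx-zx (v b) _ _ ⟩
      z^ (suc k) * v b - z^ (suc j) * v b ≈⟨ x≈y⇒x∙y⁻¹≈ε (≈-trans (≈-sym va≈k) va≈j) ⟩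
      0#                                  ∎)
    where
    va≈k : v a ≈ z^ (suc k) * v b
    va≈k = Equivalence.to (ratio⇔ (edgeForm-ratio k) v) edgeForm-k≈0
    va≈j : v a ≈ z^ (suc j) * v b
    va≈j = Equivalence.to (ratio⇔ (edgeForm-ratio j) v) edgeForm-j≈0
    open import Relation.Binary.Reasoning.Setoid setoid
    z^k-z^j≉0 : ¬ (z^ (suc k) - z^ (suc j) ≈ 0#)
    z^k-z^j≉0 eq = j≢k (≡.sym (z^suc-injective k<r j<r (x∙y⁻¹≈ε⇒x≈y _ _ eq)))

  χ-contracted : ℤ
  χ-contracted = χₘ.χ-on [] (M C)

  χ-on-edgeForms : ∀ ks → All (_< r) ks → Unique ks →
    χₙ.χ-on [] (map edgeForm ks ++ M D) ≡ χₙ.χ-on [] (M D) ℤ.- + length ks ℤ.* χ-contracted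
  χ-on-edgeForms []       _            _            =
    ≡.sym (≡.trans (≡.cong (λ x → χₙ.χ-on [] (M D) ℤ.- x) (ℤ.*-zeroˡ χ-contracted)) (ℤ.+-identityʳ _))
  χ-on-edgeForms (k ∷ ks) (k<r ∷ ks<r) (k∉ks ∷ ks!) = begin
    χₙ.χ-on [] (map edgeForm ks ++ M D) ℤ.- χₙ.χ-on (edgeForm k ∷ []) (map edgeForm ks ++ M D)
      ≡⟨ ≡.cong₂ ℤ._-_ (χ-on-edgeForms ks ks<r ks!) (χₙ.χ-on-++-absorbed (edgeForm k ∷ []) (map edgeForm ks) (M D) absorbed) ⟩
    (χₙ.χ-on [] (M D) ℤ.- + length ks ℤ.* χ-contracted) ℤ.- χₙ.χ-on (edgeForm k ∷ []) (M D)
      ≡⟨ ≡.cong (λ x → (χₙ.χ-on [] (M D) ℤ.- + length ks ℤ.* χ-contracted) ℤ.- x) (χ-on-edgeForm k) ⟩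
    (χₙ.χ-on [] (M D) ℤ.- + length ks ℤ.* χ-contracted) ℤ.- χ-contracted
      ≡⟨ regroup (χₙ.χ-on [] (M D)) (+ length ks) χ-contracted ⟩
    χₙ.χ-on [] (M D) ℤ.- + length (k ∷ ks) ℤ.* χ-contracted ∎
    where
    open ≡.≡-Reasoning
    regroup : ∀ Y L X → (Y ℤ.- L ℤ.* X) ℤ.- X ≡ Y ℤ.- (ℤ.1ℤ ℤ.+ L) ℤ.* X
    regroup = solve-∀
    absorbed : χₙ.Absorbed (edgeForm k ∷ []) (map edgeForm ks) (M D)
    absorbed α∈ with ∈-map⁻ edgeForm α∈
    ... | j , j∈ks , refl = coord K b , coord∈M D b , λ v (edgeForm-k≈0 , _) edgeForm-j≈0 →
      ≈-trans (eval-coord b v)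
        (edgeForms-meet-in-x_b≈0 (All.lookup ks<r j∈ks) k<r (λ j≡k → All.lookup k∉ks j∈ks (≡.sym j≡k)) v edgeForm-k≈0 edgeForm-j≈0)

  deletion-contraction : charPoly K dim (M G) t ≡ charPoly K dim (M D) t ℤ.- + r ℤ.* charPoly K dim′ (M C) t
  deletion-contraction = begin
    charPoly K dim (M G) t
      ≡⟨ χₙ.charPoly≡χ-on[] (M G) ⟩
    χₙ.χ-on [] (M G)
      ≡⟨ χ-deletion ⟩
    χₙ.χ-on [] (edgeForms ++ M D)
      ≡⟨ χ-on-edgeForms (upTo r) (All.tabulate ∈-upTo⁻) (upTo⁺ r) ⟩
    χₙ.χ-on [] (M D) ℤ.- + length (upTo r) ℤ.* χ-contracted
      ≡⟨ ≡.cong₂ (λ Y L → Y ℤ.- + L ℤ.* χ-contracted) (≡.sym (χₙ.charPoly≡χ-on[] (M D))) (length-upTo r) ⟩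
    charPoly K dim (M D) t ℤ.- + r ℤ.* χ-contracted
      ≡⟨ ≡.cong (λ x → charPoly K dim (M D) t ℤ.- + r ℤ.* x) (≡.sym (χₘ.charPoly≡χ-on[] (M C))) ⟩
    charPoly K dim (M D) t ℤ.- + r ℤ.* charPoly K dim′ (M C) t ∎
    where open ≡.≡-Reasoning

open import Level using (Level)
open import Data.Nat using (_≥_; s≤s; z≤n)
open import Data.Integer using (_-_; _*_; +_)

mainTheorem5 : ∀ {c ℓ : Level} (K : Field c ℓ) (r : ℕ) → r ≥ 1 →
    (z : Field.Carrier K) → IsPrimitiveRoot K r z →
    ∀ (m : ℕ) (G : Adjacency (suc m)) → IsSimpleGraph G →
    (i₁ i₂ : Fin (suc m)) → (G i₁ i₂ ≡ true) → (ne : i₁ ≢ i₂) →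
    (dim : List (Form K (suc m)) → ℕ) → IsDimFun K dim →
    (dim′ : List (Form K m) → ℕ) → IsDimFun K dim′ →
    ∀ (t : ℤ) →
      charPoly K dim (graphicMonomial K G r z) t
        ≡ charPoly K dim (graphicMonomial K (deleteEdge G i₁ i₂) r z) t
          - (+ r) * charPoly K dim′ (graphicMonomial K (contractEdge G i₁ i₂ ne) r z) t
mainTheorem5 K (suc r′) (s≤s z≤n) z isPrimitive m G simple i₁ i₂ G-i₁i₂ i₁≢i₂ dim isDim dim′ isDim′ t =
  DeletionContraction.deletion-contraction K r′ z isPrimitive G simple i₁ i₂ G-i₁i₂ i₁≢i₂ dim isDim dim′ isDim′ t
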